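{- For all $n\geq 1$, some maximizer of $P$ over $D(n)$ lies in $C(n)$. Consequently, every maximizer of $P$ over $C(n)$ is a maximizer of $P$ over $D(n)$.
   Context: A multigraph is $(V,w)$ with $w:\binom V2\to\mathbb{N}$; $\mu(G)=\max w$, $P(G)=\prod w$. An $(s,q)$-graph is one in which every $s$ vertices span total multiplicity at most $q$; $F(n,s,q)$ is the set of $(s,q)$-graphs on $[n]$. $D(n)=\{G\in F(n,4,15):\mu(G)\le 3\}\cap F(n,3,8)$. An $(i,j,k)$-triangle is a 3-set of vertices whose multiset of pair multiplicities is $\{i,j,k\}$. $C(n)$ is the set of $G\in D(n)$ with no $(3,1,1)$-, $(2,1,1)$- or $(3,2,1)$-triangle. -}

module Defs where

open import Data.Nat using (ℕ; _≤_; _<_; _⊔_; _<ᵇ_)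
open import Data.Bool using (if_then_else_)
open import Data.Fin using (Fin; toℕ)
open import Data.Fin.Subset using (Subset; _∈_; ∣_∣)
open import Data.List using (List; []; _∷_; [_]; concatMap; map; filter; foldr; allFin)
open import Data.Nat.ListAction using (sum; product)
open import Data.Fin.Subset.Properties using (_∈?_)
open import Relation.Nullary.Decidable using (_×-dec_)
open import Data.Product using (_×_; _,_; Σ; proj₁; proj₂)
open import Relation.Nullary using (¬_)
open import Relation.Binary.PropositionalEquality using (_≡_)
open import Data.List.Relation.Binary.Permutation.Propositional using (_↭_)

-- A multigraph on [n] = Fin n: the multiplicity of the pair {i,j} (i < j) is  w i j.
-- Only entries with toℕ i < toℕ j are ever used; other entries are irrelevant.
Multigraph : ℕ → Set
Multigraph n = Fin n → Fin n → ℕ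

pairs : (n : ℕ) → List (Fin n × Fin n)
pairs n = concatMap (λ i → concatMap (λ j → if toℕ i <ᵇ toℕ j then [ (i , j) ] else []) (allFin n)) (allFin n)

mult : ∀ {n} → Multigraph n → Fin n × Fin n → ℕ
mult w (i , j) = w i j

P : ∀ {n} → Multigraph n → ℕ
P {n} w = product (map (mult w) (pairs n))

μ : ∀ {n} → Multigraph n → ℕ
μ {n} w = foldr _⊔_ 0 (map (mult w) (pairs n))

pairsIn : ∀ {n} → Subset n → List (Fin n × Fin n)
pairsIn {n} S = filter (λ p → (proj₁ p ∈? S) ×-dec (proj₂ p ∈? S)) (pairs n)

spanned : ∀ {n} → Multigraph n → Subset n → ℕ
spanned w S = sum (map (mult w) (pairsIn S))

IsSQ : ∀ {n} → ℕ → ℕ → Multigraph n → Set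
IsSQ {n} s q w = (S : Subset n) → ∣ S ∣ ≡ s → spanned w S ≤ q

D : (n : ℕ) → Multigraph n → Set
D n w = IsSQ 4 15 w × μ w ≤ 3 × IsSQ 3 8 w

HasTriangle : ∀ {n} → Multigraph n → ℕ → ℕ → ℕ → Set
HasTriangle {n} w i j k =
  Σ (Fin n) λ a → Σ (Fin n) λ b → Σ (Fin n) λ c →
    toℕ a < toℕ b × toℕ b < toℕ c ×
    ((w a b ∷ w a c ∷ w b c ∷ []) ↭ (i ∷ j ∷ k ∷ []))

C : (n : ℕ) → Multigraph n → Set
C n w = D n w × ¬ HasTriangle w 3 1 1 × ¬ HasTriangle w 2 1 1 × ¬ HasTriangle w 3 2 1

IsMaximizer : ∀ {n} → (Multigraph n → Set) → Multigraph n → Set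
IsMaximizer {n} X w = X w × ((v : Multigraph n) → X v → P v ≤ P w)

-- Take a maximizer G of P over D(n); symmetrizing it, we may assume G x y = G y x. Call (x, y, z) bad when
-- xy has multiplicity 1 and z sees x and y with different multiplicities: every (3,1,1)-, (2,1,1)- and
-- (3,2,1)-triangle contains a bad triple, so it suffices to find a maximizer without one.
-- Given a bad (u, v, w), clone u v G makes u a twin of v (joined to v by a single edge), and both clones
-- stay in D(n). Splitting P(G)², the product over ordered pairs, by whether a pair meets u, v or both gives
-- P(G)² = A·C·D, P(clone u v G)² = A·D² and P(clone v u G)² = A·C², so maximality forces C = D and both
-- clones are again maximizers. Splitting the number of bad ordered triples in the same way gives a + b + c + d
-- for G with b ≥ 1 (it counts (u, v, w)), against a + 2d and a + 2c for the clones, so one of them has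
-- fewer bad triples. Iterating ends at a maximizer that lies in C(n).

module Submission where

open import Defs

open import Algebra.Bundles using (CommutativeMonoid)
open import Data.Bool using (true; false; if_then_else_; T)
open import Data.Fin using (Fin; zero; suc; toℕ; _≟_; fromℕ<; finToFun; funToFin)
open import Data.Fin.Permutation using (Permutation; _⟨$⟩ʳ_; _⟨$⟩ˡ_; inverseˡ; inverseʳ; transpose)
open import Data.Fin.Properties using (toℕ-injective; suc-injective; finToFun-funToFin; toℕ-fromℕ<)
open import Data.Fin.Subset using (Subset; ∣_∣; ⋃; ⁅_⁆) renaming (_∈_ to _∈ₛ_)
open import Data.Fin.Subset.Properties
  using (anySubset?; drop-there; ∉⊥; x∈⁅x⁆; x∈⁅y⁆⇒x≡y; x∈p∪q⁻; x∈p∪q⁺)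
  renaming (_∈?_ to _∈ₛ?_)
open import Data.List using (List; []; _∷_; map; length; foldr; concatMap; filter; allFin; tabulate; [_]; _++_)
open import Data.List.Extrema.Nat using (argmax; argmax-all; f[xs]≤f[argmax])
import Data.List.Membership.Propositional as List
import Data.List.Membership.Propositional.Properties as List
open import Data.List.Membership.Propositional.Properties using (∈-filter⁺; ∈-filter⁻; ∈-allFin)
import Data.List.Properties as List
open import Data.List.Relation.Binary.Permutation.Propositional
  using (_↭_; refl; prep; swap; trans; ↭-trans; ↭-sym; ↭⇒↭ₛ)
import Data.List.Relation.Binary.Permutation.Propositional.Properties as ↭
import Data.List.Relation.Binary.Permutation.Setoid.Properties as ↭ₛ
open import Data.List.Relation.Unary.All as All using (All; []; _∷_)
open import Data.List.Relation.Unary.All.Properties using (all-filter)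
import Data.List.Relation.Unary.Any as LAny
open import Data.List.Relation.Unary.Unique.Propositional using (Unique; []; _∷_)
import Data.List.Relation.Unary.Unique.Propositional.Properties as Unique
open import Data.Nat using (ℕ; zero; suc; _+_; _*_; _^_; _⊓_; _≤_; _<_; _<?_; _<ᵇ_; z≤n; s≤s; z<s)
open import Data.Nat.Induction using (<-wellFounded)
open import Data.Nat.ListAction using () renaming (sum to sumˡ)
open import Data.Nat.ListAction.Properties using (sum-↭)
open import Data.Nat.Properties
  using ( +-0-commutativeMonoid; *-1-commutativeMonoid; ⊔-0-commutativeMonoid; +-commutativeSemigroup
        ; +-mono-≤; +-monoʳ-≤; +-identityʳ; +-assoc
        ; ≤-refl; ≤-trans; ≤-antisym; <-asym; ≮⇒≥; <-cmp; n≮n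
        ; <ᵇ⇒<; <⇒<ᵇ; m≤m+n; m≤n+m; ⊔-lub; m⊔n≤o⇒m≤o; m⊔n≤o⇒n≤o; module ≤-Reasoning)
import Data.Nat.Properties as ℕ
open import Algebra.Properties.CommutativeSemigroup +-commutativeSemigroup
  using () renaming (interchange to +-interchange)
open import Data.Product using (Σ; _×_; _,_; proj₁; proj₂; ∃)
import Data.Product as Product
open import Data.Sum using (_⊎_; inj₁; inj₂; [_,_]′)
open import Data.Vec using (Vec; []; _∷_) renaming (here to hereₛ; there to thereₛ)
import Data.Vec as Vec
open import Data.Vec.Functional using (replicate)
open import Data.Vec.Membership.Propositional using (_∈_; _∉_)
open import Data.Vec.Relation.Unary.Any using (here; there)
import Data.Vec.Relation.Unary.Any as VAny
import Data.Vec.Relation.Unary.Any.Properties as VAny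
open import Function using (_∘_; _⇔_; mk⇔; Equivalence; case_of_)
open import Function.Construct.Composition using (_⇔-∘_)
open import Function.Construct.Identity using (⇔-id)
open import Induction.WellFounded using (Acc; acc)
open import Level using (Level; 0ℓ)
open import Relation.Binary.Definitions using (tri<; tri≈; tri>)
open import Relation.Binary.PropositionalEquality as ≡
  using (_≡_; _≢_; refl; cong; cong₂; module ≡-Reasoning)
open import Relation.Nullary using (Dec; yes; no; does; ¬_; _×-dec_; ¬?; contradiction)
open import Relation.Nullary.Decidable using (dec-true; dec-false; map′; decidable-stable)
open import Relation.Unary using (Pred; Decidable)

_∈?_ : ∀ {n k} (u : Fin n) (xs : Vec (Fin n) k) → Dec (u ∈ xs)
u ∈? xs = VAny.any? (u ≟_) xs

Unique-resp-↭ : ∀ {A : Set} {xs ys : List A} → xs ↭ ys → Unique xs → Unique ys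
Unique-resp-↭ {A} xs↭ys = ↭ₛ.Unique-resp-↭ (≡.setoid A) (↭⇒↭ₛ xs↭ys)

↭-pair : ∀ {A : Set} {x y : A} {xs} → x List.∈ xs → y List.∈ xs → x ≢ y →
  ∃ λ zs → xs ↭ x ∷ y ∷ zs
↭-pair {x = x} {y} x∈ y∈ x≢y with List.∈-∃++ x∈
... | as , bs , refl with ↭.∈-resp-↭ (↭.shift x as bs) y∈
...   | LAny.here y≡x  = contradiction (≡.sym y≡x) x≢y
...   | LAny.there y∈′ with List.∈-∃++ y∈′
...     | cs , ds , eq = cs ++ ds , ↭-trans (↭.shift x as bs) (prep x ys↭)
  where
  ys↭ : as ++ bs ↭ y ∷ cs ++ ds
  ys↭ = ≡.subst (_↭ y ∷ cs ++ ds) (≡.sym eq) (↭.shift y cs ds)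

↭-pair-≢ : ∀ {y z p q : ℕ} → (y ∷ z ∷ []) ↭ (p ∷ q ∷ []) → p ≢ q → y ≢ z
↭-pair-≢ {y} {p = p} {q} yz↭pq p≢q refl =
  p≢q (≡.trans (only-y (from (LAny.here refl))) (≡.sym (only-y (from (LAny.there (LAny.here refl))))))
  where
  from : ∀ {w} → w List.∈ p ∷ q ∷ [] → w List.∈ y ∷ y ∷ []
  from = ↭.∈-resp-↭ (↭-sym yz↭pq)
  only-y : ∀ {w} → w List.∈ y ∷ y ∷ [] → w ≡ y
  only-y (LAny.here w≡y)              = w≡y
  only-y (LAny.there (LAny.here w≡y)) = w≡y

↭-one-unbalanced : ∀ {x y z p q : ℕ} → (x ∷ y ∷ z ∷ []) ↭ (1 ∷ p ∷ q ∷ []) → p ≢ q →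
  (x ≡ 1 × y ≢ z) ⊎ (y ≡ 1 × x ≢ z) ⊎ (z ≡ 1 × x ≢ y)
↭-one-unbalanced {x} {y} xyz↭ p≢q with ↭.∈-resp-↭ (↭-sym xyz↭) (LAny.here refl)
... | LAny.here refl =
  inj₁ (refl , ↭-pair-≢ (↭.drop-∷ xyz↭) p≢q)
... | LAny.there (LAny.here refl) =
  inj₂ (inj₁ (refl , ↭-pair-≢ (↭.drop-mid (x ∷ []) [] xyz↭) p≢q))
... | LAny.there (LAny.there (LAny.here refl)) =
  inj₂ (inj₂ (refl , ↭-pair-≢ (↭.drop-mid (x ∷ y ∷ []) [] xyz↭) p≢q))

⟨$⟩ʳ-injective : ∀ {n} (π : Permutation n n) {x y} → π ⟨$⟩ʳ x ≡ π ⟨$⟩ʳ y → x ≡ y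
⟨$⟩ʳ-injective π eq = ≡.trans (≡.sym (inverseˡ π)) (≡.trans (cong (π ⟨$⟩ˡ_) eq) (inverseˡ π))

transpose-matchˡ : ∀ {n} (i j : Fin n) → transpose i j ⟨$⟩ʳ i ≡ j
transpose-matchˡ i j rewrite dec-true (i ≟ i) refl = refl

transpose-matchʳ : ∀ {n} (i j : Fin n) → transpose i j ⟨$⟩ʳ j ≡ i
transpose-matchʳ i j with j ≟ i
... | yes refl = refl
... | no _ rewrite dec-true (j ≟ j) refl = refl

transpose-other : ∀ {n} {i j k : Fin n} → k ≢ i → k ≢ j → transpose i j ⟨$⟩ʳ k ≡ k
transpose-other {i = i} {j} {k} k≢i k≢j rewrite dec-false (k ≟ i) k≢i | dec-false (k ≟ j) k≢j = refl

∈-map-permutation : ∀ {n k} (π : Permutation n n) {u} {xs : Vec (Fin n) k} →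
  u ∈ Vec.map (π ⟨$⟩ʳ_) xs ⇔ π ⟨$⟩ˡ u ∈ xs
∈-map-permutation π {u} = mk⇔
  (VAny.map (λ { {x} refl → inverseˡ π {x} }) ∘ VAny.map⁻)
  (VAny.map⁺ ∘ VAny.map (λ { refl → ≡.sym (inverseʳ π {u}) }))

Upper : ∀ {n} → Pred (Fin n × Fin n) 0ℓ
Upper (i , j) = toℕ i < toℕ j

upper? : ∀ {n} → Decidable (Upper {n})
upper? (i , j) = toℕ i <? toℕ j

Both Only Neither : ∀ {n k} → Fin n → Fin n → Pred (Vec (Fin n) k) 0ℓ
Both    u v xs = u ∈ xs × v ∈ xs
Only    u v xs = u ∈ xs × v ∉ xs
Neither u v xs = u ∉ xs × v ∉ xs

both? : ∀ {n k} (u v : Fin n) → Decidable (Both {n} {k} u v)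
both? u v xs = u ∈? xs ×-dec v ∈? xs

only? : ∀ {n k} (u v : Fin n) → Decidable (Only {n} {k} u v)
only? u v xs = u ∈? xs ×-dec ¬? (v ∈? xs)

neither? : ∀ {n k} (u v : Fin n) → Decidable (Neither {n} {k} u v)
neither? u v xs = ¬? (u ∈? xs) ×-dec ¬? (v ∈? xs)

module FiniteSums {c ℓ : Level} (M : CommutativeMonoid c ℓ) where

  open CommutativeMonoid M renaming (Carrier to A; refl to ≈-refl; sym to ≈-sym; trans to ≈-trans)
  open import Algebra.Properties.CommutativeMonoid.Sum M public using (sum; sum-syntax; ∑-comm)
  open import Algebra.Properties.CommutativeMonoid.Sum M
    using (sum-cong-≋; ∑-distrib-+; sum-permute; sum-replicate-zero)
  open import Algebra.Properties.CommutativeSemigroup commutativeSemigroup using (interchange)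
  open import Relation.Binary.Reasoning.Setoid setoid

  ∑-cong : ∀ {n} {f g : Fin n → A} → (∀ i → f i ≈ g i) → sum f ≈ sum g
  ∑-cong = sum-cong-≋

  ∑-ε : ∀ {n} (f : Fin n → A) → (∀ i → f i ≈ ε) → ∑[ i < n ] f i ≈ ε
  ∑-ε {n} f f≈ε = ≈-trans (∑-cong {g = replicate n ε} f≈ε) (sum-replicate-zero n)

  -- Opaque, so that unification never sees through to the underlying if_then_else_.
  opaque
    select : ∀ {p} {I : Set} {P : Pred I p} → Decidable P → (I → A) → I → A
    select P? f i = if does (P? i) then f i else ε

    select-resp : ∀ {p q} {I J : Set} {P : Pred I p} {Q : Pred J q} (P? : Decidable P) (Q? : Decidable Q)
      (f : I → A) (g : J → A) {i j} → P i ⇔ Q j → (P i → f i ≈ g j) → select P? f i ≈ select Q? g j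
    select-resp P? Q? f g {i} {j} P⇔Q f≈g with P? i | Q? j
    ... | yes p | yes _  = f≈g p
    ... | yes p | no ¬q  = contradiction (Equivalence.to P⇔Q p) ¬q
    ... | no ¬p | yes q  = contradiction (Equivalence.from P⇔Q q) ¬p
    ... | no _  | no _   = ≈-refl

    select-in : ∀ {p} {I : Set} {P : Pred I p} (P? : Decidable P) (f : I → A) {i} →
      P i → select P? f i ≈ f i
    select-in P? f {i} p with P? i
    ... | yes _ = ≈-refl
    ... | no ¬p = contradiction p ¬p

    select-out : ∀ {p} {I : Set} {P : Pred I p} (P? : Decidable P) (f : I → A) {i} →
      ¬ P i → select P? f i ≈ ε
    select-out P? f {i} ¬p with P? i
    ... | yes p = contradiction p ¬p
    ... | no _  = ≈-refl

  select-cong : ∀ {p} {I : Set} {P : Pred I p} (P? : Decidable P) (f g : I → A) {i} →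
    (P i → f i ≈ g i) → select P? f i ≈ select P? g i
  select-cong P? f g = select-resp P? P? f g (⇔-id _)

  select-ε : ∀ {p} {I : Set} {P : Pred I p} (P? : Decidable P) (f : I → A) {i} →
    (P i → f i ≈ ε) → select P? f i ≈ ε
  select-ε P? f {i} f≈ε with P? i
  ... | yes p = ≈-trans (select-in P? f p) (f≈ε p)
  ... | no ¬p = select-out P? f ¬p

  ∑ᵛ : ∀ {n} k → (Vec (Fin n) k → A) → A
  ∑ᵛ zero    F = F []
  ∑ᵛ {n} (suc k) F = ∑[ x < n ] ∑ᵛ k (F ∘ (x ∷_))

  ∑ᵛ-cong : ∀ {n} k {F G : Vec (Fin n) k → A} → (∀ xs → F xs ≈ G xs) → ∑ᵛ k F ≈ ∑ᵛ k G
  ∑ᵛ-cong zero    F≈G = F≈G []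
  ∑ᵛ-cong (suc k) F≈G = ∑-cong (λ x → ∑ᵛ-cong k (F≈G ∘ (x ∷_)))

  ∑ᵛ-distrib : ∀ {n} k (F G : Vec (Fin n) k → A) →
    ∑ᵛ k (λ xs → F xs ∙ G xs) ≈ ∑ᵛ k F ∙ ∑ᵛ k G
  ∑ᵛ-distrib zero    F G = ≈-refl
  ∑ᵛ-distrib (suc k) F G = ≈-trans
    (∑-cong (λ x → ∑ᵛ-distrib k (F ∘ (x ∷_)) (G ∘ (x ∷_))))
    (∑-distrib-+ (λ x → ∑ᵛ k (F ∘ (x ∷_))) (λ x → ∑ᵛ k (G ∘ (x ∷_))))

  ∑ᵛ-ε : ∀ {n} k → ∑ᵛ {n} k (λ _ → ε) ≈ ε
  ∑ᵛ-ε zero        = ≈-refl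
  ∑ᵛ-ε {n} (suc k) = ∑-ε {n} (λ _ → ∑ᵛ {n} k (λ _ → ε)) (λ _ → ∑ᵛ-ε k)

  ∑ᵛ-permute : ∀ {n} k (π : Permutation n n) (F : Vec (Fin n) k → A) →
    ∑ᵛ k (F ∘ Vec.map (π ⟨$⟩ʳ_)) ≈ ∑ᵛ k F
  ∑ᵛ-permute zero    π F = ≈-refl
  ∑ᵛ-permute (suc k) π F = begin
    ∑[ x < _ ] ∑ᵛ k (λ xs → F ((π ⟨$⟩ʳ x) ∷ Vec.map (π ⟨$⟩ʳ_) xs))
      ≈⟨ ∑-cong (λ x → ∑ᵛ-permute k π (F ∘ ((π ⟨$⟩ʳ x) ∷_))) ⟩
    ∑[ x < _ ] ∑ᵛ k (F ∘ ((π ⟨$⟩ʳ x) ∷_))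
      ≈⟨ sum-permute (λ y → ∑ᵛ k (F ∘ (y ∷_))) π ⟨
    ∑[ y < _ ] ∑ᵛ k (F ∘ (y ∷_))
      ∎

  ∑ᵛ-select-permute : ∀ {n k p q} (π : Permutation n n)
    {P : Pred (Vec (Fin n) k) p} {Q : Pred (Vec (Fin n) k) q} (P? : Decidable P) (Q? : Decidable Q)
    (F : Vec (Fin n) k → A) → (∀ xs → P xs ⇔ Q (Vec.map (π ⟨$⟩ʳ_) xs)) →
    ∑ᵛ k (select P? (F ∘ Vec.map (π ⟨$⟩ʳ_))) ≈ ∑ᵛ k (select Q? F)
  ∑ᵛ-select-permute {k = k} π P? Q? F P⇔Q = begin
    ∑ᵛ k (select P? (F ∘ Vec.map (π ⟨$⟩ʳ_)))
      ≈⟨ ∑ᵛ-cong k (λ xs → select-resp P? Q? _ F (P⇔Q xs) (λ _ → ≈-refl)) ⟩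
    ∑ᵛ k (select Q? F ∘ Vec.map (π ⟨$⟩ʳ_))
      ≈⟨ ∑ᵛ-permute k π (select Q? F) ⟩
    ∑ᵛ k (select Q? F)
      ∎

  ∑-neither ∑-both ∑-only : ∀ {n} k (u v : Fin n) → (Vec (Fin n) k → A) → A
  ∑-neither k u v F = ∑ᵛ k (select (neither? u v) F)
  ∑-both    k u v F = ∑ᵛ k (select (both? u v) F)
  ∑-only    k u v F = ∑ᵛ k (select (only? u v) F)

  ∑-neither-comm : ∀ {n} k (u v : Fin n) (F : Vec (Fin n) k → A) → ∑-neither k u v F ≈ ∑-neither k v u F
  ∑-neither-comm k u v F = ∑ᵛ-cong k λ _ →
    select-resp (neither? u v) (neither? v u) F F (mk⇔ Product.swap Product.swap) (λ _ → ≈-refl)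

  ∑-both-comm : ∀ {n} k (u v : Fin n) (F : Vec (Fin n) k → A) → ∑-both k u v F ≈ ∑-both k v u F
  ∑-both-comm k u v F = ∑ᵛ-cong k λ _ →
    select-resp (both? u v) (both? v u) F F (mk⇔ Product.swap Product.swap) (λ _ → ≈-refl)

  ∑ᵛ-regions : ∀ {n} k (u v : Fin n) (F : Vec (Fin n) k → A) →
    ∑ᵛ k F ≈ (∑-neither k u v F ∙ ∑-both k u v F) ∙ (∑-only k u v F ∙ ∑-only k v u F)
  ∑ᵛ-regions k u v F = begin
    ∑ᵛ k F
      ≈⟨ ∑ᵛ-cong k split ⟩
    ∑ᵛ k (λ xs → (N xs ∙ B xs) ∙ (U xs ∙ V xs))
      ≈⟨ ∑ᵛ-distrib k _ _ ⟩
    ∑ᵛ k (λ xs → N xs ∙ B xs) ∙ ∑ᵛ k (λ xs → U xs ∙ V xs)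
      ≈⟨ ∙-cong (∑ᵛ-distrib k N B) (∑ᵛ-distrib k U V) ⟩
    (∑-neither k u v F ∙ ∑-both k u v F) ∙ (∑-only k u v F ∙ ∑-only k v u F)
      ∎
    where
    N = select (neither? u v) F
    B = select (both? u v) F
    U = select (only? u v) F
    V = select (only? v u) F
    εε≈ε = identityˡ ε
    out-N = select-out (neither? u v) F
    out-B = select-out (both? u v) F
    out-U = select-out (only? u v) F
    out-V = select-out (only? v u) F
    split : ∀ xs → F xs ≈ (N xs ∙ B xs) ∙ (U xs ∙ V xs)
    split xs with u ∈? xs | v ∈? xs
    ... | yes u∈ | yes v∈ = ≈-sym (≈-trans
      (∙-cong (∙-cong (out-N λ (u∉ , _) → u∉ u∈) (select-in (both? u v) F (u∈ , v∈)))
              (∙-cong (out-U λ (_ , v∉) → v∉ v∈) (out-V λ (_ , u∉) → u∉ u∈)))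
      (≈-trans (∙-cong (identityˡ _) εε≈ε) (identityʳ _)))
    ... | yes u∈ | no v∉  = ≈-sym (≈-trans
      (∙-cong (∙-cong (out-N λ (u∉ , _) → u∉ u∈) (out-B λ (_ , v∈) → v∉ v∈))
              (∙-cong (select-in (only? u v) F (u∈ , v∉)) (out-V λ (v∈ , _) → v∉ v∈)))
      (≈-trans (∙-cong εε≈ε (identityʳ _)) (identityˡ _)))
    ... | no u∉  | yes v∈ = ≈-sym (≈-trans
      (∙-cong (∙-cong (out-N λ (_ , v∉) → v∉ v∈) (out-B λ (u∈ , _) → u∉ u∈))
              (∙-cong (out-U λ (u∈ , _) → u∉ u∈) (select-in (only? v u) F (v∈ , u∉))))
      (≈-trans (∙-cong εε≈ε (identityˡ _)) (identityˡ _)))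
    ... | no u∉  | no v∉  = ≈-sym (≈-trans
      (∙-cong (∙-cong (select-in (neither? u v) F (u∉ , v∉)) (out-B λ (u∈ , _) → u∉ u∈))
              (∙-cong (out-U λ (u∈ , _) → u∉ u∈) (out-V λ (v∈ , _) → v∉ v∈)))
      (≈-trans (∙-cong (identityʳ _) εε≈ε) (identityʳ _)))

  ∑ᵛ-clone : ∀ {n} k (u v : Fin n) (π : Permutation n n) → π ⟨$⟩ˡ u ≡ v → π ⟨$⟩ˡ v ≡ u →
    (F F′ : Vec (Fin n) k → A) →
    (∀ xs → u ∉ xs → F′ xs ≈ F xs) →
    (∀ xs → v ∉ xs → F′ xs ≈ F (Vec.map (π ⟨$⟩ʳ_) xs)) →
    ∑ᵛ k F′ ≈ (∑-neither k u v F ∙ ∑-both k u v F′) ∙ (∑-only k v u F ∙ ∑-only k v u F)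
  ∑ᵛ-clone k u v π πu πv F F′ away-u away-v = begin
    ∑ᵛ k F′
      ≈⟨ ∑ᵛ-regions k u v F′ ⟩
    (∑-neither k u v F′ ∙ ∑-both k u v F′) ∙ (∑-only k u v F′ ∙ ∑-only k v u F′)
      ≈⟨ ∙-cong (∙-congʳ neither≈) (∙-cong only-u≈ only-v≈) ⟩
    (∑-neither k u v F ∙ ∑-both k u v F′) ∙ (∑-only k v u F ∙ ∑-only k v u F)
      ∎
    where
    neither≈ : ∑-neither k u v F′ ≈ ∑-neither k u v F
    neither≈ = ∑ᵛ-cong k (λ xs → select-cong (neither? u v) F′ F (away-u xs ∘ proj₁))
    only-v≈ : ∑-only k v u F′ ≈ ∑-only k v u F
    only-v≈ = ∑ᵛ-cong k (λ xs → select-cong (only? v u) F′ F (away-u xs ∘ proj₂))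
    relabel : ∀ xs → Only u v xs ⇔ Only v u (Vec.map (π ⟨$⟩ʳ_) xs)
    relabel xs = mk⇔
      (λ (u∈ , v∉) → into (≡.subst (_∈ xs) (≡.sym πv) u∈) , v∉ ∘ ≡.subst (_∈ xs) πu ∘ outof)
      (λ (v∈ , u∉) → ≡.subst (_∈ xs) πv (outof v∈) , u∉ ∘ into ∘ ≡.subst (_∈ xs) (≡.sym πu))
      where
      into : ∀ {w} → π ⟨$⟩ˡ w ∈ xs → w ∈ Vec.map (π ⟨$⟩ʳ_) xs
      into = Equivalence.from (∈-map-permutation π)
      outof : ∀ {w} → w ∈ Vec.map (π ⟨$⟩ʳ_) xs → π ⟨$⟩ˡ w ∈ xs
      outof = Equivalence.to (∈-map-permutation π)
    only-u≈ : ∑-only k u v F′ ≈ ∑-only k v u F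
    only-u≈ = ≈-trans
      (∑ᵛ-cong k (λ xs → select-cong (only? u v) F′ (F ∘ Vec.map (π ⟨$⟩ʳ_)) (away-v xs ∘ proj₂)))
      (∑ᵛ-select-permute π (only? u v) (only? v u) F relabel)

  fold : ∀ {I : Set} → (I → A) → List I → A
  fold f xs = foldr _∙_ ε (map f xs)

  fold-++ : ∀ {I : Set} (f : I → A) xs ys → fold f (xs ++ ys) ≈ fold f xs ∙ fold f ys
  fold-++ f []       ys = ≈-sym (identityˡ _)
  fold-++ f (x ∷ xs) ys = ≈-trans (∙-congˡ (fold-++ f xs ys)) (≈-sym (assoc _ _ _))

  fold-concatMap : ∀ {I J : Set} (f : J → A) (g : I → List J) xs →
    fold f (concatMap g xs) ≈ fold (fold f ∘ g) xs
  fold-concatMap f g []       = ≈-refl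
  fold-concatMap f g (x ∷ xs) = ≈-trans (fold-++ f (g x) (concatMap g xs)) (∙-congˡ (fold-concatMap f g xs))

  fold-filter : ∀ {p} {I : Set} {P : Pred I p} (P? : Decidable P) (f : I → A) xs →
    fold f (filter P? xs) ≈ fold (select P? f) xs
  fold-filter P? f []       = ≈-refl
  fold-filter P? f (x ∷ xs) with P? x
  ... | yes p = ∙-cong (≈-sym (select-in P? f p)) (fold-filter P? f xs)
  ... | no ¬p = ≈-trans (fold-filter P? f xs)
                        (≈-sym (≈-trans (∙-congʳ (select-out P? f ¬p)) (identityˡ _)))

  fold-∙ : ∀ {I : Set} (f g : I → A) xs → fold (λ i → f i ∙ g i) xs ≈ fold f xs ∙ fold g xs
  fold-∙ f g []       = ≈-sym (identityˡ ε)
  fold-∙ f g (x ∷ xs) = ≈-trans (∙-congˡ (fold-∙ f g xs)) (interchange _ _ _ _)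

  fold-cong : ∀ {I : Set} {f g : I → A} {xs} → All (λ x → f x ≈ g x) xs → fold f xs ≈ fold g xs
  fold-cong []           = ≈-refl
  fold-cong (fx≈gx ∷ eq) = ∙-cong fx≈gx (fold-cong eq)

  fold-ε : ∀ {I : Set} {f : I → A} → (∀ x → f x ≈ ε) → ∀ xs → fold f xs ≈ ε
  fold-ε f≈ε []       = ≈-refl
  fold-ε f≈ε (x ∷ xs) = ≈-trans (∙-cong (f≈ε x) (fold-ε f≈ε xs)) (identityˡ ε)

  fold-tabulate : ∀ {n} {I : Set} (f : I → A) (g : Fin n → I) → fold f (tabulate g) ≈ ∑[ i < n ] f (g i)
  fold-tabulate {zero}  f g = ≈-refl
  fold-tabulate {suc n} f g = ∙-congˡ (fold-tabulate f (g ∘ suc))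

  fold-allFin : ∀ {n} (f : Fin n → A) → fold f (allFin n) ≈ ∑[ i < n ] f i
  fold-allFin f = fold-tabulate f (λ i → i)

  fold-pairs : ∀ {n} (f : Fin n × Fin n → A) →
    fold f (pairs n) ≈ ∑[ i < n ] ∑[ j < n ] select upper? f (i , j)
  fold-pairs {n} f = begin
    fold f (pairs n)
      ≈⟨ fold-concatMap f row (allFin n) ⟩
    fold (fold f ∘ row) (allFin n)
      ≈⟨ fold-allFin (fold f ∘ row) ⟩
    ∑[ i < n ] fold f (row i)
      ≈⟨ ∑-cong (λ i → ≈-trans (fold-concatMap f (cell i) (allFin n)) (fold-allFin (fold f ∘ cell i))) ⟩
    ∑[ i < n ] ∑[ j < n ] fold f (cell i j)
      ≈⟨ ∑-cong (λ i → ∑-cong (λ j → fold-cell i j)) ⟩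
    ∑[ i < n ] ∑[ j < n ] select upper? f (i , j)
      ∎
    where
    cell : Fin n → Fin n → List (Fin n × Fin n)
    cell i j = if toℕ i <ᵇ toℕ j then [ (i , j) ] else []
    row : Fin n → List (Fin n × Fin n)
    row i = concatMap (cell i) (allFin n)
    fold-cell : ∀ i j → fold f (cell i j) ≈ select upper? f (i , j)
    fold-cell i j with toℕ i <ᵇ toℕ j in i<ᵇj
    ... | true  = ≈-trans (identityʳ _)
                          (≈-sym (select-in upper? f (<ᵇ⇒< _ _ (≡.subst T (≡.sym i<ᵇj) _))))
    ... | false = ≈-sym (select-out upper? f (λ i<j → ≡.subst T i<ᵇj (<⇒<ᵇ i<j)))

  fold-pairs-cong : ∀ {n} {f g : Fin n × Fin n → A} →
    (∀ {i j} → toℕ i < toℕ j → f (i , j) ≈ g (i , j)) → fold f (pairs n) ≈ fold g (pairs n)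
  fold-pairs-cong {n} {f} {g} f≈g = begin
    fold f (pairs n)
      ≈⟨ fold-pairs f ⟩
    ∑[ i < n ] ∑[ j < n ] select upper? f (i , j)
      ≈⟨ ∑-cong {f = λ i → ∑[ j < n ] select upper? f (i , j)} (λ i →
           ∑-cong {f = λ j → select upper? f (i , j)} (λ j → select-cong upper? f g f≈g)) ⟩
    ∑[ i < n ] ∑[ j < n ] select upper? g (i , j)
      ≈⟨ fold-pairs g ⟨
    fold g (pairs n)
      ∎

  ∑-select-≡ : ∀ {n} (x : Fin n) (f : Fin n → A) → ∑[ i < n ] select (_≟ x) f i ≈ f x
  ∑-select-≡ {suc n} zero    f = ≈-trans
    (∙-cong (select-in (_≟ zero) f refl)
            (∑-ε (λ i → select (_≟ zero) f (suc i)) (λ _ → select-out (_≟ zero) f λ ())))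
    (identityʳ _)
  ∑-select-≡ {suc n} (suc x) f = ≈-trans
    (∙-cong (select-out (_≟ suc x) f λ ())
            (∑-cong {f = λ i → select (_≟ suc x) f (suc i)} λ _ →
               select-resp (_≟ suc x) (_≟ x) f (f ∘ suc) (mk⇔ suc-injective (cong suc)) (λ _ → ≈-refl)))
    (≈-trans (identityˡ _) (∑-select-≡ x (f ∘ suc)))

  ∑-select-enumeration : ∀ {n p} {P : Pred (Fin n) p} (P? : Decidable P) (f : Fin n → A) {xs} →
    Unique xs → (∀ i → P i ⇔ i List.∈ xs) → ∑[ i < n ] select P? f i ≈ fold f xs
  ∑-select-enumeration P? f {[]} [] P⇔∈ =
    ∑-ε _ (λ i → select-ε P? f (λ p → contradiction (Equivalence.to (P⇔∈ i) p) λ ()))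
  ∑-select-enumeration {n} P? f {x ∷ xs} (x∉xs ∷ unique) P⇔∈ = begin
    ∑[ i < n ] select P? f i
      ≈⟨ ∑-cong split ⟩
    ∑[ i < n ] (select (_≟ x) f i ∙ select ∈xs? f i)
      ≈⟨ ∑-distrib-+ (select (_≟ x) f) (select ∈xs? f) ⟩
    ∑[ i < n ] select (_≟ x) f i ∙ ∑[ i < n ] select ∈xs? f i
      ≈⟨ ∙-cong (∑-select-≡ x f) (∑-select-enumeration ∈xs? f unique (λ _ → ⇔-id _)) ⟩
    f x ∙ fold f xs
      ∎
    where
    ∈xs? : Decidable (List._∈ xs)
    ∈xs? i = LAny.any? (i ≟_) xs
    split : ∀ i → select P? f i ≈ select (_≟ x) f i ∙ select ∈xs? f i
    split i with P? i | i ≟ x | ∈xs? i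
    ... | _     | yes refl | yes i∈ = contradiction refl (All.lookup x∉xs i∈)
    ... | yes p | yes refl | no i∉  = ≈-trans (select-in P? f p)
      (≈-sym (≈-trans (∙-cong (select-in (_≟ x) f refl) (select-out ∈xs? f i∉)) (identityʳ _)))
    ... | yes p | no i≢x   | yes i∈ = ≈-trans (select-in P? f p)
      (≈-sym (≈-trans (∙-cong (select-out (_≟ x) f i≢x) (select-in ∈xs? f i∈)) (identityˡ _)))
    ... | yes p | no i≢x   | no i∉  with Equivalence.to (P⇔∈ i) p
    ...   | LAny.here i≡x  = contradiction i≡x i≢x
    ...   | LAny.there i∈  = contradiction i∈ i∉
    split i | no ¬p | yes refl | _      = contradiction (Equivalence.from (P⇔∈ i) (LAny.here refl)) ¬p
    split i | no ¬p | no _     | yes i∈ = contradiction (Equivalence.from (P⇔∈ i) (LAny.there i∈)) ¬p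
    split i | no ¬p | no i≢x   | no i∉  = ≈-trans (select-out P? f ¬p)
      (≈-sym (≈-trans (∙-cong (select-out (_≟ x) f i≢x) (select-out ∈xs? f i∉)) (identityˡ ε)))

module Sum  = FiniteSums +-0-commutativeMonoid
module Prod = FiniteSums *-1-commutativeMonoid
module Max  = FiniteSums ⊔-0-commutativeMonoid

≤-∑ : ∀ {n} (f : Fin n → ℕ) i → f i ≤ Sum.sum f
≤-∑ f zero    = m≤m+n _ _
≤-∑ f (suc i) = ≤-trans (≤-∑ (f ∘ suc) i) (m≤n+m _ _)

≤-∑ᵛ : ∀ {n} k (F : Vec (Fin n) k → ℕ) xs → F xs ≤ Sum.∑ᵛ k F
≤-∑ᵛ zero    F []       = ≤-refl
≤-∑ᵛ (suc k) F (x ∷ xs) =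
  ≤-trans (≤-∑ᵛ k (F ∘ (x ∷_)) xs) (≤-∑ (λ y → Sum.∑ᵛ k (F ∘ (y ∷_))) x)

∑-positive : ∀ {n} (f : Fin n → ℕ) → 0 < Sum.sum f → ∃ λ i → 0 < f i
∑-positive {suc n} f 0<∑ with f zero in f0≡
... | suc _ = zero , ≡.subst (0 <_) (≡.sym f0≡) z<s
... | zero  = let i , 0<fi = ∑-positive (f ∘ suc) 0<∑ in suc i , 0<fi

∑ᵛ-positive : ∀ {n} k (F : Vec (Fin n) k → ℕ) → 0 < Sum.∑ᵛ k F → ∃ λ xs → 0 < F xs
∑ᵛ-positive zero    F 0<F = [] , 0<F
∑ᵛ-positive (suc k) F 0<∑ =
  let x , 0<∑x = ∑-positive (λ y → Sum.∑ᵛ k (F ∘ (y ∷_))) 0<∑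
      xs , 0<F = ∑ᵛ-positive k (F ∘ (x ∷_)) 0<∑x
  in x ∷ xs , 0<F

fold-≤ : ∀ {I : Set} {f : I → ℕ} {m xs} → All (λ x → f x ≤ m) xs → Sum.fold f xs ≤ length xs * m
fold-≤ []         = z≤n
fold-≤ (fx≤m ∷ p) = +-mono-≤ fx≤m (fold-≤ p)

⨆≤⇔ : ∀ {n} (f : Fin n → ℕ) {m} → Max.sum f ≤ m ⇔ (∀ i → f i ≤ m)
⨆≤⇔ f = mk⇔ (bounded f) (bound f)
  where
  bounded : ∀ {n} (f : Fin n → ℕ) {m} → Max.sum f ≤ m → ∀ i → f i ≤ m
  bounded f ⨆≤m zero    = m⊔n≤o⇒m≤o _ _ ⨆≤m
  bounded f ⨆≤m (suc i) = bounded (f ∘ suc) (m⊔n≤o⇒n≤o _ _ ⨆≤m) i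
  bound : ∀ {n} (f : Fin n → ℕ) {m} → (∀ i → f i ≤ m) → Max.sum f ≤ m
  bound {zero}  f f≤m = z≤n
  bound {suc n} f f≤m = ⊔-lub (f≤m zero) (bound (f ∘ suc) (f≤m ∘ suc))

positive-factors : ∀ {m n} → 0 < m * n → 0 < m × 0 < n
positive-factors {suc m} {zero}  pos = contradiction (≡.subst (0 <_) (ℕ.*-zeroʳ (suc m)) pos) (n≮n 0)
positive-factors {suc m} {suc n} _   = z<s , z<s

square-injective : ∀ {m n} → m * m ≡ n * n → m ≡ n
square-injective {m} {n} eq with <-cmp m n
... | tri< m<n _ _ = contradiction eq (ℕ.<⇒≢ (ℕ.*-mono-< m<n m<n))
... | tri≈ _ m≡n _ = m≡n
... | tri> _ _ n<m = contradiction (≡.sym eq) (ℕ.<⇒≢ (ℕ.*-mono-< n<m n<m))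

balanced : ∀ {a c d} → 0 < a * (c * d) → a * (d * d) ≤ a * (c * d) → a * (c * c) ≤ a * (c * d) → c ≡ d
balanced {a} {c} {d} pos dd≤cd cc≤cd with positive-factors {a} pos
... | s≤s _ , cd>0 with positive-factors {c} cd>0
...   | s≤s _ , s≤s _ = ≤-antisym (ℕ.*-cancelˡ-≤ c (ℕ.*-cancelˡ-≤ a cc≤cd))
                                (ℕ.*-cancelʳ-≤ d c d (ℕ.*-cancelˡ-≤ a dd≤cd))

shrink : ∀ {b} a c d → 0 < b → a + 0 + (d + d) < a + b + (c + d) ⊎ a + 0 + (c + c) < a + b + (c + d)
shrink a c d 0<b with ℕ.≤-total d c
... | inj₁ d≤c = inj₁ (ℕ.+-mono-<-≤ (ℕ.+-monoʳ-< a 0<b) (ℕ.+-monoˡ-≤ d d≤c))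
... | inj₂ c≤d = inj₂ (ℕ.+-mono-<-≤ (ℕ.+-monoʳ-< a 0<b) (+-monoʳ-≤ c c≤d))

IsSym : ∀ {n} → Multigraph n → Set
IsSym G = ∀ x y → G x y ≡ G y x

-- Defs reads a multigraph only at the pairs i < j; _≐_ is agreement there.
_≐_ : ∀ {n} → Multigraph n → Multigraph n → Set
G ≐ H = ∀ {i j} → toℕ i < toℕ j → G i j ≡ H i j

≐-sym : ∀ {n} {G H : Multigraph n} → G ≐ H → H ≐ G
≐-sym G≐H i<j = ≡.sym (G≐H i<j)

module _ {n : ℕ} {G H : Multigraph n} (G≐H : G ≐ H) where

  P-resp-≐ : P G ≡ P H
  P-resp-≐ = Prod.fold-pairs-cong G≐H

  μ-resp-≐ : μ G ≡ μ H
  μ-resp-≐ = Max.fold-pairs-cong G≐H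

  spanned-resp-≐ : ∀ S → spanned G S ≡ spanned H S
  spanned-resp-≐ S = begin
    spanned G S                                ≡⟨ Sum.fold-filter inS? (mult G) (pairs n) ⟩
    Sum.fold (select inS? (mult G)) (pairs n)  ≡⟨ Sum.fold-pairs-cong (λ i<j →
                                                    Sum.select-cong inS? (mult G) (mult H) (λ _ → G≐H i<j)) ⟩
    Sum.fold (select inS? (mult H)) (pairs n)  ≡⟨ Sum.fold-filter inS? (mult H) (pairs n) ⟨
    spanned H S                                ∎
    where
    open ≡-Reasoning
    open Sum using (select)
    inS? = λ (p : Fin n × Fin n) → (proj₁ p ∈ₛ? S) ×-dec (proj₂ p ∈ₛ? S)

  IsSQ-resp-≐ : ∀ {s q} → IsSQ s q G → IsSQ s q H
  IsSQ-resp-≐ sq S ∣S∣≡s = ≡.subst (_≤ _) (spanned-resp-≐ S) (sq S ∣S∣≡s)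

  D-resp-≐ : D n G → D n H
  D-resp-≐ (sq₄ , μ≤3 , sq₃) =
    IsSQ-resp-≐ sq₄ , ≡.subst (_≤ 3) μ-resp-≐ μ≤3 , IsSQ-resp-≐ sq₃

symmetrize : ∀ {n} → Multigraph n → Multigraph n
symmetrize G i j with toℕ i <? toℕ j
... | yes _ = G i j
... | no _  = G j i

symmetrize-sym : ∀ {n} (G : Multigraph n) → IsSym (symmetrize G)
symmetrize-sym G i j with toℕ i <? toℕ j | toℕ j <? toℕ i
... | yes i<j | yes j<i = contradiction j<i (<-asym i<j)
... | yes _   | no _    = refl
... | no _    | yes _   = refl
... | no i≮j  | no j≮i  with toℕ-injective (≤-antisym (≮⇒≥ j≮i) (≮⇒≥ i≮j))
...   | refl = refl

symmetrize-≐ : ∀ {n} (G : Multigraph n) → symmetrize G ≐ G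
symmetrize-≐ G {i} {j} i<j with toℕ i <? toℕ j
... | yes _   = refl
... | no i≮j  = contradiction i<j i≮j

μ≤⇔ : ∀ {n} {G : Multigraph n} {m} → μ G ≤ m ⇔ (∀ {i j} → toℕ i < toℕ j → G i j ≤ m)
μ≤⇔ {n} {G} {m} = mk⇔
  (λ μ≤m {i} {j} i<j → ≡.subst (_≤ m) (Max.select-in upper? (mult G) i<j)
     (Equivalence.to (⨆≤⇔ _) (Equivalence.to (⨆≤⇔ _) (≡.subst (_≤ m) μ≡ μ≤m) i) j))
  (λ bound → ≡.subst (_≤ m) (≡.sym μ≡)
     (Equivalence.from (⨆≤⇔ _) λ i → Equivalence.from (⨆≤⇔ _) λ j → case upper? (i , j) of λ where
       (yes i<j) → ≡.subst (_≤ m) (≡.sym (Max.select-in upper? (mult G) i<j)) (bound i<j)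
       (no i≮j)  → ≡.subst (_≤ m) (≡.sym (Max.select-out upper? (mult G) i≮j)) z≤n))
  where
  μ≡ : μ G ≡ Max.sum (λ i → Max.sum (λ j → Max.select upper? (mult G) (i , j)))
  μ≡ = Max.fold-pairs (mult G)

pairWeight : ∀ {n} → Multigraph n → List (Fin n) → ℕ
pairWeight G []       = 0
pairWeight G (x ∷ xs) = Sum.fold (G x) xs + pairWeight G xs

IsSQ′ : ∀ {n} → ℕ → ℕ → Multigraph n → Set
IsSQ′ {n} s q G = ∀ (xs : List (Fin n)) → Unique xs → length xs ≡ s → pairWeight G xs ≤ q

upperPart : ∀ {n} → Multigraph n → Fin n → Fin n → ℕ
upperPart G i j = Sum.select upper? (mult G) (i , j)

module _ {n : ℕ} {G : Multigraph n} (G-sym : IsSym G) where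

  upperPart-pair : ∀ {x y} → x ≢ y → upperPart G x y + upperPart G y x ≡ G x y
  upperPart-pair {x} {y} x≢y with <-cmp (toℕ x) (toℕ y)
  ... | tri< x<y _ y≮x = ≡.trans
    (cong₂ _+_ (Sum.select-in upper? (mult G) x<y) (Sum.select-out upper? (mult G) y≮x)) (+-identityʳ _)
  ... | tri≈ _ x≡y _   = contradiction (toℕ-injective x≡y) x≢y
  ... | tri> x≮y _ y<x = ≡.trans
    (cong₂ _+_ (Sum.select-out upper? (mult G) x≮y) (Sum.select-in upper? (mult G) y<x)) (G-sym y x)

  upperPart-double-sum : ∀ {xs} → Unique xs →
    Sum.fold (λ p → Sum.fold (upperPart G p) xs) xs ≡ pairWeight G xs
  upperPart-double-sum {[]}     []                = refl
  upperPart-double-sum {x ∷ ys} (x∉ys ∷ unique) = begin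
    (L x x + Sum.fold (L x) ys) + Sum.fold (λ p → L p x + Sum.fold (L p) ys) ys
      ≡⟨ cong₂ _+_ (cong (_+ Sum.fold (L x) ys) (Sum.select-out upper? (mult G) {x , x} (n≮n _)))
                   (Sum.fold-∙ (λ p → L p x) (λ p → Sum.fold (L p) ys) ys) ⟩
    Sum.fold (L x) ys + (Sum.fold (λ p → L p x) ys + Sum.fold (λ p → Sum.fold (L p) ys) ys)
      ≡⟨ +-assoc (Sum.fold (L x) ys) (Sum.fold (λ p → L p x) ys) _ ⟨
    (Sum.fold (L x) ys + Sum.fold (λ p → L p x) ys) + Sum.fold (λ p → Sum.fold (L p) ys) ys
      ≡⟨ cong₂ _+_ (Sum.fold-∙ (L x) (λ p → L p x) ys) (≡.sym (upperPart-double-sum unique)) ⟨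
    Sum.fold (λ q → L x q + L q x) ys + pairWeight G ys
      ≡⟨ cong (_+ _) (Sum.fold-cong (All.map upperPart-pair x∉ys)) ⟩
    Sum.fold (G x) ys + pairWeight G ys
      ∎
    where
    open ≡-Reasoning
    L = upperPart G

  -- spanned is a quadratic form in the indicator of S, so it can be evaluated on any enumeration of S.
  spanned-enumeration : ∀ {S : Subset n} {xs} → Unique xs → (∀ i → i ∈ₛ S ⇔ i List.∈ xs) →
    spanned G S ≡ pairWeight G xs
  spanned-enumeration {S} {xs} unique S⇔xs = begin
    spanned G S
      ≡⟨ Sum.fold-filter inS? (mult G) (pairs n) ⟩
    Sum.fold (select inS? (mult G)) (pairs n)
      ≡⟨ Sum.fold-pairs (select inS? (mult G)) ⟩
    Sum.sum (λ i → Sum.sum (λ j → select upper? (select inS? (mult G)) (i , j)))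
      ≡⟨ Sum.∑-cong {f = λ i → Sum.sum (λ j → select upper? (select inS? (mult G)) (i , j))} factor ⟩
    Sum.sum (select (_∈ₛ? S) (λ i → Sum.sum (select (_∈ₛ? S) (upperPart G i))))
      ≡⟨ Sum.∑-select-enumeration (_∈ₛ? S) _ unique S⇔xs ⟩
    Sum.fold (λ i → Sum.sum (select (_∈ₛ? S) (upperPart G i))) xs
      ≡⟨ Sum.fold-cong (All.tabulate {xs = xs} λ {i} _ →
           Sum.∑-select-enumeration (_∈ₛ? S) (upperPart G i) unique S⇔xs) ⟩
    Sum.fold (λ i → Sum.fold (upperPart G i) xs) xs
      ≡⟨ upperPart-double-sum unique ⟩
    pairWeight G xs
      ∎
    where
    open ≡-Reasoning
    open Sum using (select)
    inS? = λ (p : Fin n × Fin n) → (proj₁ p ∈ₛ? S) ×-dec (proj₂ p ∈ₛ? S)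
    row : ∀ {i} → i ∈ₛ S → ∀ j →
      select upper? (select inS? (mult G)) (i , j) ≡ select (_∈ₛ? S) (upperPart G i) j
    row {i} i∈S j = case j ∈ₛ? S of λ where
      (yes j∈S) → ≡.trans (Sum.select-cong upper? _ (mult G) λ _ → Sum.select-in inS? (mult G) (i∈S , j∈S))
                          (≡.sym (Sum.select-in (_∈ₛ? S) (upperPart G i) j∈S))
      (no j∉S)  → ≡.trans (Sum.select-ε upper? _ (λ _ → Sum.select-out inS? (mult G) (j∉S ∘ proj₂)))
                          (≡.sym (Sum.select-out (_∈ₛ? S) (upperPart G i) j∉S))
    factor : ∀ i → Sum.sum (λ j → select upper? (select inS? (mult G)) (i , j))
                 ≡ select (_∈ₛ? S) (λ i → Sum.sum (select (_∈ₛ? S) (upperPart G i))) i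
    factor i = case i ∈ₛ? S of λ where
      (yes i∈S) → ≡.trans (Sum.∑-cong {f = λ j → select upper? (select inS? (mult G)) (i , j)} (row i∈S))
                          (≡.sym (Sum.select-in (_∈ₛ? S) _ i∈S))
      (no i∉S)  → ≡.trans (Sum.∑-ε _ λ j → Sum.select-ε upper? (select inS? (mult G)) {i , j} λ _ →
                                             Sum.select-out inS? (mult G) (i∉S ∘ proj₁))
                          (≡.sym (Sum.select-out (_∈ₛ? S) _ i∉S))

∣∣≡∑ : ∀ {n} (S : Subset n) → ∣ S ∣ ≡ Sum.sum (Sum.select (_∈ₛ? S) (λ _ → 1))
∣∣≡∑-suc : ∀ {n} b (S : Subset n) →
  ∣ S ∣ ≡ Sum.sum (λ i → Sum.select (_∈ₛ? (b ∷ S)) (λ _ → 1) (suc i))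
∣∣≡∑ []          = refl
∣∣≡∑ (true ∷ S)  =
  cong₂ _+_ (≡.sym (Sum.select-in (_∈ₛ? (true ∷ S)) _ {zero} hereₛ)) (∣∣≡∑-suc true S)
∣∣≡∑ (false ∷ S) =
  cong₂ _+_ (≡.sym (Sum.select-out (_∈ₛ? (false ∷ S)) _ {zero} λ ())) (∣∣≡∑-suc false S)
∣∣≡∑-suc b S = ≡.trans (∣∣≡∑ S) (Sum.∑-cong {f = Sum.select (_∈ₛ? S) _} λ _ →
  Sum.select-resp (_∈ₛ? S) (_∈ₛ? (b ∷ S)) _ _ (mk⇔ thereₛ drop-there) (λ _ → refl))

size-enumeration : ∀ {n} {S : Subset n} {xs} → Unique xs → (∀ i → i ∈ₛ S ⇔ i List.∈ xs) →
  ∣ S ∣ ≡ length xs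
size-enumeration {S = S} {xs} unique S⇔xs =
  ≡.trans (∣∣≡∑ S) (≡.trans (Sum.∑-select-enumeration (_∈ₛ? S) _ unique S⇔xs) (fold-1 xs))
  where
  fold-1 : ∀ ys → Sum.fold (λ _ → 1) ys ≡ length ys
  fold-1 []       = refl
  fold-1 (_ ∷ ys) = cong suc (fold-1 ys)

∈-⋃⁅⁆ : ∀ {n} {i : Fin n} xs → i ∈ₛ ⋃ (map ⁅_⁆ xs) ⇔ i List.∈ xs
∈-⋃⁅⁆ []       = mk⇔ (λ i∈⊥ → contradiction i∈⊥ ∉⊥) λ ()
∈-⋃⁅⁆ (x ∷ xs) = mk⇔
  (λ i∈ → [ LAny.here ∘ x∈⁅y⁆⇒x≡y x , LAny.there ∘ Equivalence.to (∈-⋃⁅⁆ xs) ]′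
             (x∈p∪q⁻ ⁅ x ⁆ _ i∈))
  (λ { (LAny.here refl) → x∈p∪q⁺ (inj₁ (x∈⁅x⁆ x))
     ; (LAny.there i∈)  → x∈p∪q⁺ (inj₂ (Equivalence.from (∈-⋃⁅⁆ xs) i∈)) })

elements : ∀ {n} → Subset n → List (Fin n)
elements {n} S = filter (_∈ₛ? S) (allFin n)

∈-elements : ∀ {n} {i : Fin n} S → i ∈ₛ S ⇔ i List.∈ elements S
∈-elements {i = i} S =
  mk⇔ (∈-filter⁺ (_∈ₛ? S) (∈-allFin i)) (proj₂ ∘ ∈-filter⁻ (_∈ₛ? S) {xs = allFin _})

elements-unique : ∀ {n} (S : Subset n) → Unique (elements S)
elements-unique {n} S = Unique.filter⁺ (_∈ₛ? S) {allFin n} (Unique.allFin⁺ n)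

IsSQ⇔IsSQ′ : ∀ {n} {G : Multigraph n} → IsSym G → ∀ {s q} → IsSQ s q G ⇔ IsSQ′ s q G
IsSQ⇔IsSQ′ G-sym = mk⇔
  (λ sq xs unique len≡s → let S⇔xs = λ i → ∈-⋃⁅⁆ xs in
     ≡.subst (_≤ _) (spanned-enumeration G-sym unique S⇔xs)
       (sq _ (≡.trans (size-enumeration unique S⇔xs) len≡s)))
  (λ sq′ S ∣S∣≡s → let S⇔xs = λ i → ∈-elements S ; unique = elements-unique S in
     ≡.subst (_≤ _) (≡.sym (spanned-enumeration G-sym unique S⇔xs))
       (sq′ (elements S) unique (≡.trans (≡.sym (size-enumeration unique S⇔xs)) ∣S∣≡s)))

pairWeight-pair : ∀ {n} (G : Multigraph n) x y → pairWeight G (x ∷ y ∷ []) ≡ G x y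
pairWeight-pair G x y = ≡.trans (+-identityʳ _) (+-identityʳ _)

IsSQ′-2⇔ : ∀ {n} {G : Multigraph n} → IsSym G → ∀ {m} →
  (∀ {i j} → toℕ i < toℕ j → G i j ≤ m) ⇔ IsSQ′ 2 m G
IsSQ′-2⇔ {G = G} G-sym {m} = mk⇔
  (λ { bound (x ∷ y ∷ []) ((x≢y ∷ []) ∷ _) refl →
         ≡.subst (_≤ m) (≡.sym (pairWeight-pair G x y)) (distinct x≢y bound) })
  (λ sq′ {i} {j} i<j → ≡.subst (_≤ m) (pairWeight-pair G i j)
     (sq′ (i ∷ j ∷ []) (((λ { refl → n≮n _ i<j }) ∷ []) ∷ [] ∷ []) refl))
  where
  distinct : ∀ {x y} → x ≢ y → (∀ {i j} → toℕ i < toℕ j → G i j ≤ m) → G x y ≤ m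
  distinct {x} {y} x≢y bound with <-cmp (toℕ x) (toℕ y)
  ... | tri< x<y _ _ = bound x<y
  ... | tri≈ _ x≡y _ = contradiction (toℕ-injective x≡y) x≢y
  ... | tri> _ _ y<x = ≡.subst (_≤ m) (G-sym y x) (bound y<x)

-- μ ≤ 3 is the span bound for lists of two vertices.
D′ : ∀ {n} → Multigraph n → Set
D′ G = IsSQ′ 4 15 G × IsSQ′ 2 3 G × IsSQ′ 3 8 G

D⇔D′ : ∀ {n} {G : Multigraph n} → IsSym G → D n G ⇔ D′ G
D⇔D′ {G = G} G-sym = mk⇔
  (λ (sq₄ , μ≤3 , sq₃) → to sq₄ , Equivalence.to μ≤3⇔sq₂ μ≤3 , to sq₃)
  (λ (sq₄ , sq₂ , sq₃) → from sq₄ , Equivalence.from μ≤3⇔sq₂ sq₂ , from sq₃)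
  where
  to : ∀ {s q} → IsSQ s q G → IsSQ′ s q G
  to = Equivalence.to (IsSQ⇔IsSQ′ G-sym)
  from : ∀ {s q} → IsSQ′ s q G → IsSQ s q G
  from = Equivalence.from (IsSQ⇔IsSQ′ G-sym)
  μ≤3⇔sq₂ : μ G ≤ 3 ⇔ IsSQ′ 2 3 G
  μ≤3⇔sq₂ = IsSQ′-2⇔ G-sym ⇔-∘ μ≤⇔

pairWeight-↭ : ∀ {n} {G : Multigraph n} → IsSym G → ∀ {xs ys} → xs ↭ ys →
  pairWeight G xs ≡ pairWeight G ys
pairWeight-↭ G-sym refl = refl
pairWeight-↭ {G = G} G-sym (prep x p) = cong₂ _+_ (sum-↭ (↭.map⁺ (G x) p)) (pairWeight-↭ G-sym p)
pairWeight-↭ {G = G} G-sym {x ∷ y ∷ xs} {_ ∷ _ ∷ ys} (swap x y p) = begin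
  (G x y + Sum.fold (G x) xs) + (Sum.fold (G y) xs + pairWeight G xs)
    ≡⟨ cong₂ _+_ (cong₂ _+_ (G-sym x y) (sum-↭ (↭.map⁺ (G x) p)))
                 (cong₂ _+_ (sum-↭ (↭.map⁺ (G y) p)) (pairWeight-↭ G-sym p)) ⟩
  (G y x + Sum.fold (G x) ys) + (Sum.fold (G y) ys + pairWeight G ys)
    ≡⟨ +-interchange (G y x) (Sum.fold (G x) ys) (Sum.fold (G y) ys) (pairWeight G ys) ⟩
  (G y x + Sum.fold (G y) ys) + (Sum.fold (G x) ys + pairWeight G ys)
    ∎
  where open ≡-Reasoning
pairWeight-↭ G-sym (trans p q) = ≡.trans (pairWeight-↭ G-sym p) (pairWeight-↭ G-sym q)

pairWeight-cong : ∀ {n} {G H : Multigraph n} {xs} → Unique xs →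
  (∀ {x y} → x List.∈ xs → y List.∈ xs → x ≢ y → G x y ≡ H x y) →
  pairWeight G xs ≡ pairWeight H xs
pairWeight-cong {xs = []}     []                G≡H = refl
pairWeight-cong {xs = x ∷ xs} (x∉xs ∷ unique) G≡H = cong₂ _+_
  (Sum.fold-cong (All.tabulate λ y∈ → G≡H (LAny.here refl) (LAny.there y∈) (All.lookup x∉xs y∈)))
  (pairWeight-cong unique λ x∈ y∈ → G≡H (LAny.there x∈) (LAny.there y∈))

pairWeight-map : ∀ {n} (G : Multigraph n) (f : Fin n → Fin n) xs →
  pairWeight G (map f xs) ≡ pairWeight (λ x y → G (f x) (f y)) xs
pairWeight-map G f []       = refl
pairWeight-map G f (x ∷ xs) = cong₂ _+_ (cong sumˡ (≡.sym (List.map-∘ xs))) (pairWeight-map G f xs)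

-- Cloning a vertex

redirect : ∀ {n} → Fin n → Fin n → Fin n → Fin n
redirect u v x with x ≟ u
... | yes _ = v
... | no _  = x

-- u becomes a twin of v: it takes over v's multiplicities, and uv, the one pair that redirect u v collapses,
-- gets multiplicity 1 (as does the diagonal, which is never read).
clone : ∀ {n} → Fin n → Fin n → Multigraph n → Multigraph n
clone u v G x y with redirect u v x ≟ redirect u v y
... | yes _ = 1
... | no _  = G (redirect u v x) (redirect u v y)

module Clone {n : ℕ} {u v : Fin n} (u≢v : u ≢ v) {G : Multigraph n} (G-sym : IsSym G) where

  G′ : Multigraph n
  G′ = clone u v G

  τ : Permutation n n
  τ = transpose u v

  redirect-u : redirect u v u ≡ v
  redirect-u with u ≟ u
  ... | yes _   = refl
  ... | no u≢u = contradiction refl u≢u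

  redirect-away : ∀ {x} → x ≢ u → redirect u v x ≡ x
  redirect-away {x} x≢u with x ≟ u
  ... | yes x≡u = contradiction x≡u x≢u
  ... | no _    = refl

  redirect≡τ : ∀ {x} → x ≢ v → redirect u v x ≡ τ ⟨$⟩ʳ x
  redirect≡τ {x} x≢v = case x ≟ u of λ where
    (yes refl) → ≡.trans redirect-u (≡.sym (transpose-matchˡ u v))
    (no x≢u)   → ≡.trans (redirect-away x≢u) (≡.sym (transpose-other x≢u x≢v))

  clone-≡ : ∀ {x y} → redirect u v x ≡ redirect u v y → G′ x y ≡ 1
  clone-≡ {x} {y} eq with redirect u v x ≟ redirect u v y
  ... | yes _  = refl
  ... | no neq = contradiction eq neq

  clone-≢ : ∀ {x y} → redirect u v x ≢ redirect u v y → G′ x y ≡ G (redirect u v x) (redirect u v y)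
  clone-≢ {x} {y} neq with redirect u v x ≟ redirect u v y
  ... | yes eq = contradiction eq neq
  ... | no _   = refl

  clone-sym : IsSym G′
  clone-sym x y with redirect u v x ≟ redirect u v y | redirect u v y ≟ redirect u v x
  ... | yes _  | yes _  = refl
  ... | yes eq | no neq = contradiction (≡.sym eq) neq
  ... | no neq | yes eq = contradiction (≡.sym eq) neq
  ... | no _   | no _   = G-sym _ _

  clone-uv : G′ u v ≡ 1
  clone-uv = clone-≡ {u} {v} (≡.trans redirect-u (≡.sym (redirect-away (u≢v ∘ ≡.sym))))

  clone-u : ∀ {z} → z ≢ u → z ≢ v → G′ u z ≡ G v z
  clone-u {z} z≢u z≢v = ≡.trans
    (clone-≢ {u} {z} λ eq → z≢v (≡.sym (≡.trans (≡.sym redirect-u) (≡.trans eq (redirect-away z≢u)))))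
    (cong₂ G redirect-u (redirect-away z≢u))

  clone-away : ∀ {x y} → x ≢ u → y ≢ u → x ≢ y → G′ x y ≡ G x y
  clone-away {x} {y} x≢u y≢u x≢y = ≡.trans
    (clone-≢ {x} {y} λ eq → x≢y (≡.trans (≡.sym (redirect-away x≢u)) (≡.trans eq (redirect-away y≢u))))
    (cong₂ G (redirect-away x≢u) (redirect-away y≢u))

  clone-swap : ∀ {x y} → x ≢ v → y ≢ v → x ≢ y → G′ x y ≡ G (τ ⟨$⟩ʳ x) (τ ⟨$⟩ʳ y)
  clone-swap {x} {y} x≢v y≢v x≢y = ≡.trans
    (clone-≢ {x} {y} λ eq →
       x≢y (⟨$⟩ʳ-injective τ (≡.trans (≡.sym (redirect≡τ x≢v)) (≡.trans eq (redirect≡τ y≢v)))))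
    (cong₂ G (redirect≡τ x≢v) (redirect≡τ y≢v))

  clone-pairWeight-away : ∀ {xs} → Unique xs → u List.∉ xs → pairWeight G′ xs ≡ pairWeight G xs
  clone-pairWeight-away unique u∉ =
    pairWeight-cong unique (λ x∈ y∈ → clone-away (λ { refl → u∉ x∈ }) (λ { refl → u∉ y∈ }))

  clone-pairWeight-swap : ∀ {xs} → Unique xs → v List.∉ xs →
    pairWeight G′ xs ≡ pairWeight G (map (τ ⟨$⟩ʳ_) xs)
  clone-pairWeight-swap {xs} unique v∉ = ≡.trans
    (pairWeight-cong unique (λ x∈ y∈ → clone-swap (λ { refl → v∉ x∈ }) (λ { refl → v∉ y∈ })))
    (≡.sym (pairWeight-map G (τ ⟨$⟩ʳ_) xs))

  clone-pairWeight-twin : ∀ {zs} → Unique (u ∷ v ∷ zs) →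
    pairWeight G′ (u ∷ v ∷ zs) ≡ (1 + Sum.fold (G v) zs) + pairWeight G (v ∷ zs)
  clone-pairWeight-twin {zs} ((_ ∷ u∉zs) ∷ (v∉zs ∷ unique)) = cong₂ _+_
    (cong₂ _+_ clone-uv (Sum.fold-cong (All.tabulate λ z∈ → clone-u (z≢ u∉zs z∈) (z≢ v∉zs z∈))))
    (cong₂ _+_ (Sum.fold-cong (All.tabulate λ z∈ →
                  clone-away (u≢v ∘ ≡.sym) (z≢ u∉zs z∈) (All.lookup v∉zs z∈)))
               (clone-pairWeight-away unique λ u∈ → All.lookup u∉zs u∈ refl))
    where
    z≢ : ∀ {w z} → All (w ≢_) zs → z List.∈ zs → z ≢ w
    z≢ w∉zs z∈ = All.lookup w∉zs z∈ ∘ ≡.sym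

  clone-twin-bound : ∀ {m q zs} → IsSQ′ 2 m G → IsSQ′ (suc (length zs)) q G → Unique (u ∷ v ∷ zs) →
    pairWeight G′ (u ∷ v ∷ zs) ≤ 1 + length zs * m + q
  clone-twin-bound {m} {q} {zs} sq₂ sq unique@(_ ∷ unique-vzs@(v∉zs ∷ _)) = begin
    pairWeight G′ (u ∷ v ∷ zs)
      ≡⟨ clone-pairWeight-twin unique ⟩
    (1 + Sum.fold (G v) zs) + pairWeight G (v ∷ zs)
      ≤⟨ +-mono-≤ (+-monoʳ-≤ 1 (fold-≤ (All.map edge v∉zs))) (sq (v ∷ zs) unique-vzs refl) ⟩
    1 + length zs * m + q
      ∎
    where
    open ≤-Reasoning
    edge : ∀ {z} → v ≢ z → G v z ≤ m
    edge v≢z = ≡.subst (_≤ m) (pairWeight-pair G v _) (sq₂ (v ∷ _ ∷ []) ((v≢z ∷ []) ∷ [] ∷ []) refl)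

  clone-IsSQ′ : ∀ {m k q q′} → IsSQ′ 2 m G → IsSQ′ (suc k) q G → IsSQ′ (2 + k) q′ G →
    1 + k * m + q ≤ q′ → IsSQ′ (2 + k) q′ G′
  clone-IsSQ′ {m} {k} {q} {q′} sq₂ sq sq′ bound xs unique len
    with LAny.any? (u ≟_) xs | LAny.any? (v ≟_) xs
  ... | no u∉  | _      = ≡.subst (_≤ q′) (≡.sym (clone-pairWeight-away unique u∉)) (sq′ xs unique len)
  ... | yes _  | no v∉  = ≡.subst (_≤ q′) (≡.sym (clone-pairWeight-swap unique v∉))
    (sq′ (map (τ ⟨$⟩ʳ_) xs) (Unique.map⁺ (⟨$⟩ʳ-injective τ) unique)
         (≡.trans (List.length-map _ xs) len))
  ... | yes u∈ | yes v∈ with ↭-pair u∈ v∈ u≢v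
  ...   | zs , xs↭ with ℕ.suc-injective (ℕ.suc-injective (≡.trans (≡.sym (↭.↭-length xs↭)) len))
  ...     | refl = ≡.subst (_≤ q′) (≡.sym (pairWeight-↭ clone-sym xs↭))
                     (≤-trans (clone-twin-bound sq₂ sq (Unique-resp-↭ xs↭ unique)) bound)

  clone-D′ : D′ G → D′ G′
  clone-D′ (sq₄ , sq₂ , sq₃) =
      clone-IsSQ′ sq₂ sq₃ sq₄ ≤-refl
    , clone-IsSQ′ sq₂ (λ { (_ ∷ []) _ refl → z≤n }) sq₂ (s≤s z≤n)
    , clone-IsSQ′ sq₂ sq₂ sq₃ (ℕ.n≤1+n 7)

  clone-D : D n G → D n G′
  clone-D = Equivalence.from (D⇔D′ clone-sym) ∘ clone-D′ ∘ Equivalence.to (D⇔D′ G-sym)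

-- Counting ordered pairs and bad triples

Distinct₂ : ∀ {n} → Pred (Vec (Fin n) 2) 0ℓ
Distinct₂ (x ∷ y ∷ []) = x ≢ y

distinct₂? : ∀ {n} → Decidable (Distinct₂ {n})
distinct₂? (x ∷ y ∷ []) = ¬? (x ≟ y)

pairFactor : ∀ {n} → Multigraph n → Vec (Fin n) 2 → ℕ
pairFactor G = Prod.select distinct₂? λ { (x ∷ y ∷ []) → G x y }

-- Unlike P, Q does not depend on an orientation of the pairs, so relabelling arguments apply to it.
Q : ∀ {n} → Multigraph n → ℕ
Q G = Prod.∑ᵛ 2 (pairFactor G)

P*P≡Q : ∀ {n} {G : Multigraph n} → IsSym G → P G * P G ≡ Q G
P*P≡Q {n} {G} G-sym = begin
  P G * P G
    ≡⟨ cong₂ _*_ P≡ (≡.trans P≡ (Prod.∑-comm U)) ⟩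
  Prod.∑ᵛ 2 (λ { (x ∷ y ∷ []) → U x y }) * Prod.∑ᵛ 2 (λ { (x ∷ y ∷ []) → U y x })
    ≡⟨ Prod.∑ᵛ-distrib 2 (λ { (x ∷ y ∷ []) → U x y }) (λ { (x ∷ y ∷ []) → U y x }) ⟨
  Prod.∑ᵛ 2 (λ { (x ∷ y ∷ []) → U x y * U y x })
    ≡⟨ Prod.∑ᵛ-cong 2 {F = λ { (x ∷ y ∷ []) → U x y * U y x }} {pairFactor G}
                      (λ { (x ∷ y ∷ []) → factor x y }) ⟩
  Q G
    ∎
  where
  open ≡-Reasoning
  U : Fin n → Fin n → ℕ
  U x y = Prod.select upper? (mult G) (x , y)
  P≡ : P G ≡ Prod.sum (λ x → Prod.sum (λ y → U x y))
  P≡ = Prod.fold-pairs (mult G)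
  in-U  = Prod.select-in upper? (mult G)
  out-U = Prod.select-out upper? (mult G)
  factor : ∀ x y → U x y * U y x ≡ pairFactor G (x ∷ y ∷ [])
  factor x y with <-cmp (toℕ x) (toℕ y)
  ... | tri< x<y _ y≮x = ≡.trans (cong₂ _*_ (in-U x<y) (out-U y≮x)) (≡.trans (ℕ.*-identityʳ _)
      (≡.sym (Prod.select-in distinct₂? _ {x ∷ y ∷ []} λ { refl → n≮n _ x<y })))
  ... | tri≈ x≮y x≡y y≮x = ≡.trans (cong₂ _*_ (out-U x≮y) (out-U y≮x))
      (≡.sym (Prod.select-out distinct₂? _ {x ∷ y ∷ []} λ x≢y → x≢y (toℕ-injective x≡y)))
  ... | tri> x≮y _ y<x = ≡.trans (cong₂ _*_ (out-U x≮y) (in-U y<x)) (≡.trans (+-identityʳ _)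
      (≡.trans (G-sym y x) (≡.sym (Prod.select-in distinct₂? _ {x ∷ y ∷ []} λ { refl → n≮n _ y<x }))))

Bad : ∀ {n} → Multigraph n → Fin n → Fin n → Fin n → Set
Bad G x y z = x ≢ y × x ≢ z × y ≢ z × G x y ≡ 1 × G x z ≢ G y z

BadTriple : ∀ {n} → Multigraph n → Pred (Vec (Fin n) 3) 0ℓ
BadTriple G (x ∷ y ∷ z ∷ []) = Bad G x y z

badTriple? : ∀ {n} (G : Multigraph n) → Decidable (BadTriple G)
badTriple? G (x ∷ y ∷ z ∷ []) =
  ¬? (x ≟ y) ×-dec ¬? (x ≟ z) ×-dec ¬? (y ≟ z) ×-dec G x y ℕ.≟ 1 ×-dec ¬? (G x z ℕ.≟ G y z)

badness : ∀ {n} → Multigraph n → Vec (Fin n) 3 → ℕ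
badness G = Sum.select (badTriple? G) (λ _ → 1)

β : ∀ {n} → Multigraph n → ℕ
β G = Sum.∑ᵛ 3 (badness G)

Bad-swap : ∀ {n} {G : Multigraph n} → IsSym G → ∀ {x y z} → Bad G x y z → Bad G y x z
Bad-swap G-sym (x≢y , x≢z , y≢z , xy≡1 , xz≢yz) =
  x≢y ∘ ≡.sym , y≢z , x≢z , ≡.trans (G-sym _ _) xy≡1 , xz≢yz ∘ ≡.sym

Bad-relabel : ∀ {n} {G H : Multigraph n} (f : Fin n → Fin n) → (∀ {x y} → f x ≡ f y → x ≡ y) →
  ∀ {x y z} → (x ≢ y → H x y ≡ G (f x) (f y)) → (x ≢ z → H x z ≡ G (f x) (f z)) →
  (y ≢ z → H y z ≡ G (f y) (f z)) → Bad H x y z ⇔ Bad G (f x) (f y) (f z)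
Bad-relabel f f-inj xy xz yz = mk⇔
  (λ (x≢y , x≢z , y≢z , xy≡1 , xz≢yz) →
     x≢y ∘ f-inj , x≢z ∘ f-inj , y≢z ∘ f-inj , ≡.trans (≡.sym (xy x≢y)) xy≡1 ,
     λ eq → xz≢yz (≡.trans (xz x≢z) (≡.trans eq (≡.sym (yz y≢z)))))
  (λ (fx≢fy , fx≢fz , fy≢fz , xy≡1 , xz≢yz) →
     let x≢y = fx≢fy ∘ cong f ; x≢z = fx≢fz ∘ cong f ; y≢z = fy≢fz ∘ cong f in
     x≢y , x≢z , y≢z , ≡.trans (xy x≢y) xy≡1 ,
     λ eq → xz≢yz (≡.trans (≡.sym (xz x≢z)) (≡.trans eq (yz y≢z))))

module Twins {n : ℕ} {u v : Fin n} (u≢v : u ≢ v) {G : Multigraph n} (G-sym : IsSym G) (G-uv : G u v ≡ 1)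
  where

  open Clone u≢v G-sym

  v≢u : v ≢ u
  v≢u = u≢v ∘ ≡.sym

  twin-edge : ∀ {x y} → u ∈ x ∷ y ∷ [] → v ∈ x ∷ y ∷ [] → G′ x y ≡ G x y
  twin-edge (here refl)         (here v≡u)          = contradiction v≡u v≢u
  twin-edge (here refl)         (there (here refl)) = ≡.trans clone-uv (≡.sym G-uv)
  twin-edge (there (here refl)) (here refl)         =
    ≡.trans (clone-sym v u) (≡.trans clone-uv (≡.sym (≡.trans (G-sym v u) G-uv)))
  twin-edge (there (here refl)) (there (here v≡u))  = contradiction v≡u v≢u

  twins-uvw : ∀ {w} → ¬ Bad G′ u v w
  twins-uvw (_ , u≢w , v≢w , _ , uw≢vw) =
    uw≢vw (≡.trans (clone-u (u≢w ∘ ≡.sym) (v≢w ∘ ≡.sym))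
                   (≡.sym (clone-away v≢u (u≢w ∘ ≡.sym) v≢w)))

  twins-vwu : ∀ {w} → ¬ Bad G′ v w u
  twins-vwu (v≢w , _ , w≢u , vw≡1 , vu≢wu) =
    vu≢wu (≡.trans (≡.trans (clone-sym v u) clone-uv) (≡.sym wu≡1))
    where
    Gvw≡1 = ≡.trans (≡.sym (clone-away v≢u w≢u v≢w)) vw≡1
    wu≡1  = ≡.trans (clone-sym _ u) (≡.trans (clone-u w≢u (v≢w ∘ ≡.sym)) Gvw≡1)

  twins-uwv : ∀ {w} → ¬ Bad G′ u w v
  twins-uwv (u≢w , _ , w≢v , uw≡1 , uv≢wv) = uv≢wv (≡.trans clone-uv (≡.sym wv≡1))
    where
    Gvw≡1 = ≡.trans (≡.sym (clone-u (u≢w ∘ ≡.sym) w≢v)) uw≡1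
    wv≡1  = ≡.trans (clone-sym _ v) (≡.trans (clone-away v≢u (u≢w ∘ ≡.sym) (w≢v ∘ ≡.sym)) Gvw≡1)

  -- A triangle through both twins has multiplicities 1, t, t, which is never bad.
  twins-not-bad : ∀ {x y z} → u ∈ x ∷ y ∷ z ∷ [] → v ∈ x ∷ y ∷ z ∷ [] → ¬ Bad G′ x y z
  twins-not-bad (here refl)                 (there (here refl))         = twins-uvw
  twins-not-bad (there (here refl))         (here refl)                 = twins-uvw ∘ Bad-swap clone-sym
  twins-not-bad (here refl)                 (there (there (here refl))) = twins-uwv
  twins-not-bad (there (here refl))         (there (there (here refl))) = twins-uwv ∘ Bad-swap clone-sym
  twins-not-bad (there (there (here refl))) (here refl)                 = twins-vwu
  twins-not-bad (there (there (here refl))) (there (here refl))         = twins-vwu ∘ Bad-swap clone-sym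
  twins-not-bad (here refl)                 (here v≡u)                  = contradiction v≡u v≢u
  twins-not-bad (there (here refl))         (there (here v≡u))          = contradiction v≡u v≢u
  twins-not-bad (there (there (here refl))) (there (there (here v≡u)))  = contradiction v≡u v≢u

  private
    τ-inj = ⟨$⟩ʳ-injective τ
    τˡu : τ ⟨$⟩ˡ u ≡ v
    τˡu = transpose-matchʳ v u
    τˡv : τ ⟨$⟩ˡ v ≡ u
    τˡv = transpose-matchˡ v u

  pairFactor-away : ∀ xs → u ∉ xs → pairFactor G′ xs ≡ pairFactor G xs
  pairFactor-away (x ∷ y ∷ []) u∉ = Prod.select-cong distinct₂? _ _
    (clone-away (λ { refl → u∉ (here refl) }) (λ { refl → u∉ (there (here refl)) }))

  pairFactor-swap : ∀ xs → v ∉ xs → pairFactor G′ xs ≡ pairFactor G (Vec.map (τ ⟨$⟩ʳ_) xs)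
  pairFactor-swap (x ∷ y ∷ []) v∉ = Prod.select-resp distinct₂? distinct₂? _ _
    (mk⇔ (λ x≢y → x≢y ∘ τ-inj) (λ τx≢τy → τx≢τy ∘ cong (τ ⟨$⟩ʳ_)))
    (clone-swap (λ { refl → v∉ (here refl) }) (λ { refl → v∉ (there (here refl)) }))

  Q-clone : Q G′ ≡ (Prod.∑-neither 2 u v (pairFactor G) * Prod.∑-both 2 u v (pairFactor G))
                 * (Prod.∑-only 2 v u (pairFactor G) * Prod.∑-only 2 v u (pairFactor G))
  Q-clone = ≡.trans
    (Prod.∑ᵛ-clone 2 u v τ τˡu τˡv (pairFactor G) (pairFactor G′) pairFactor-away pairFactor-swap)
    (cong (λ b → (Prod.∑-neither 2 u v (pairFactor G) * b)
               * (Prod.∑-only 2 v u (pairFactor G) * Prod.∑-only 2 v u (pairFactor G)))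
          (Prod.∑ᵛ-cong 2 both≡))
    where
    both≡ : ∀ xs → Prod.select (both? u v) (pairFactor G′) xs ≡ Prod.select (both? u v) (pairFactor G) xs
    both≡ (x ∷ y ∷ []) = Prod.select-cong (both? u v) _ _ λ (u∈ , v∈) →
      Prod.select-cong distinct₂? _ _ (λ _ → twin-edge u∈ v∈)

  badness-away : ∀ xs → u ∉ xs → badness G′ xs ≡ badness G xs
  badness-away (x ∷ y ∷ z ∷ []) u∉ = Sum.select-resp (badTriple? G′) (badTriple? G) _ _
    (Bad-relabel (λ w → w) (λ eq → eq) (clone-away x≢u y≢u) (clone-away x≢u z≢u) (clone-away y≢u z≢u))
    (λ _ → refl)
    where
    x≢u : x ≢ u
    x≢u refl = u∉ (here refl)
    y≢u : y ≢ u
    y≢u refl = u∉ (there (here refl))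
    z≢u : z ≢ u
    z≢u refl = u∉ (there (there (here refl)))

  badness-swap : ∀ xs → v ∉ xs → badness G′ xs ≡ badness G (Vec.map (τ ⟨$⟩ʳ_) xs)
  badness-swap (x ∷ y ∷ z ∷ []) v∉ = Sum.select-resp (badTriple? G′) (badTriple? G) _ _
    (Bad-relabel {G = G} (τ ⟨$⟩ʳ_) τ-inj
                 (clone-swap x≢v y≢v) (clone-swap x≢v z≢v) (clone-swap y≢v z≢v))
    (λ _ → refl)
    where
    x≢v : x ≢ v
    x≢v refl = v∉ (here refl)
    y≢v : y ≢ v
    y≢v refl = v∉ (there (here refl))
    z≢v : z ≢ v
    z≢v refl = v∉ (there (there (here refl)))

  β-clone : β G′ ≡ (Sum.∑-neither 3 u v (badness G) + 0)
                 + (Sum.∑-only 3 v u (badness G) + Sum.∑-only 3 v u (badness G))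
  β-clone = ≡.trans
    (Sum.∑ᵛ-clone 3 u v τ τˡu τˡv (badness G) (badness G′) badness-away badness-swap)
    (cong (λ b → (Sum.∑-neither 3 u v (badness G) + b)
               + (Sum.∑-only 3 v u (badness G) + Sum.∑-only 3 v u (badness G)))
          (≡.trans (Sum.∑ᵛ-cong 3 both≡0) (Sum.∑ᵛ-ε {n} 3)))
    where
    both≡0 : ∀ xs → Sum.select (both? u v) (badness G′) xs ≡ 0
    both≡0 (x ∷ y ∷ z ∷ []) = Sum.select-ε (both? u v) _ λ (u∈ , v∈) →
      Sum.select-out (badTriple? G′) _ (twins-not-bad u∈ v∈)

-- Improving a maximizer

ones : ∀ {n} → Multigraph n
ones _ _ = 1

ones-D : ∀ {n} → D n ones
ones-D = Equivalence.from (D⇔D′ (λ _ _ → refl))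
  ( (λ { (_ ∷ _ ∷ _ ∷ _ ∷ []) _ refl → m≤m+n 6 9 })
  , (λ { (_ ∷ _ ∷ []) _ refl → m≤m+n 1 2 })
  , (λ { (_ ∷ _ ∷ _ ∷ []) _ refl → m≤m+n 3 5 }))

P-ones : ∀ {n} → P (ones {n}) ≡ 1
P-ones {n} = Prod.fold-ε (λ _ → refl) (pairs n)

maximizer-positive : ∀ {n} {G : Multigraph n} → IsMaximizer (D n) G → 0 < P G
maximizer-positive {n} {G} (_ , G-max) = ≡.subst (_≤ P G) (P-ones {n}) (G-max ones ones-D)

module Improve {n : ℕ} {G : Multigraph n} (G-sym : IsSym G) (G-max : IsMaximizer (D n) G)
               {u v : Fin n} (u≢v : u ≢ v) (G-uv : G u v ≡ 1) where

  private
    v≢u : v ≢ u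
    v≢u = u≢v ∘ ≡.sym
    module T₁ = Twins u≢v G-sym G-uv
    module T₂ = Twins v≢u G-sym (≡.trans (G-sym v u) G-uv)
    module C₁ = Clone u≢v G-sym
    module C₂ = Clone v≢u G-sym
    G₁ = clone u v G
    G₂ = clone v u G
    F = pairFactor G
    A = Prod.∑-neither 2 u v F
    K = Prod.∑-both 2 u v F
    Cu = Prod.∑-only 2 u v F
    Cv = Prod.∑-only 2 v u F

  Q-G : Q G ≡ (A * K) * (Cu * Cv)
  Q-G = Prod.∑ᵛ-regions 2 u v F

  Q-G₁ : Q G₁ ≡ (A * K) * (Cv * Cv)
  Q-G₁ = T₁.Q-clone

  Q-G₂ : Q G₂ ≡ (A * K) * (Cu * Cu)
  Q-G₂ = ≡.trans T₂.Q-clone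
    (cong₂ (λ a k → (a * k) * (Cu * Cu)) (Prod.∑-neither-comm 2 v u F) (Prod.∑-both-comm 2 v u F))

  Q≤Q-G : ∀ {H} → IsSym H → D n H → Q H ≤ Q G
  Q≤Q-G H-sym D-H =
    ≡.subst₂ _≤_ (P*P≡Q H-sym) (P*P≡Q G-sym) (ℕ.*-mono-≤ (proj₂ G-max _ D-H) (proj₂ G-max _ D-H))

  Cu≡Cv : Cu ≡ Cv
  Cu≡Cv = balanced {A * K} (≡.subst (0 <_) (≡.trans (P*P≡Q G-sym) Q-G) (ℕ.*-mono-< P>0 P>0))
                           (≡.subst₂ _≤_ Q-G₁ Q-G (Q≤Q-G C₁.clone-sym (C₁.clone-D D-G)))
                           (≡.subst₂ _≤_ Q-G₂ Q-G (Q≤Q-G C₂.clone-sym (C₂.clone-D D-G)))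
    where
    D-G = proj₁ G-max
    P>0 = maximizer-positive G-max

  P-G₁ : P G₁ ≡ P G
  P-G₁ = square-injective (begin
    P G₁ * P G₁            ≡⟨ P*P≡Q C₁.clone-sym ⟩
    Q G₁                   ≡⟨ Q-G₁ ⟩
    (A * K) * (Cv * Cv)    ≡⟨ cong (λ c → (A * K) * (c * Cv)) Cu≡Cv ⟨
    (A * K) * (Cu * Cv)    ≡⟨ Q-G ⟨
    Q G                    ≡⟨ P*P≡Q G-sym ⟨
    P G * P G              ∎)
    where open ≡-Reasoning

  P-G₂ : P G₂ ≡ P G
  P-G₂ = square-injective (begin
    P G₂ * P G₂            ≡⟨ P*P≡Q C₂.clone-sym ⟩
    Q G₂                   ≡⟨ Q-G₂ ⟩
    (A * K) * (Cu * Cu)    ≡⟨ cong (λ c → (A * K) * (Cu * c)) Cu≡Cv ⟩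
    (A * K) * (Cu * Cv)    ≡⟨ Q-G ⟨
    Q G                    ≡⟨ P*P≡Q G-sym ⟨
    P G * P G              ∎)
    where open ≡-Reasoning

  same-P-maximizer : ∀ {H} → D n H → P H ≡ P G → IsMaximizer (D n) H
  same-P-maximizer D-H P-H = D-H , λ K D-K → ≡.subst (P K ≤_) (≡.sym P-H) (proj₂ G-max K D-K)

  private
    B = badness G
    a = Sum.∑-neither 3 u v B
    b = Sum.∑-both 3 u v B
    cu = Sum.∑-only 3 u v B
    cv = Sum.∑-only 3 v u B

  β-G : β G ≡ (a + b) + (cu + cv)
  β-G = Sum.∑ᵛ-regions 3 u v B

  β-G₁ : β G₁ ≡ (a + 0) + (cv + cv)
  β-G₁ = T₁.β-clone

  β-G₂ : β G₂ ≡ (a + 0) + (cu + cu)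
  β-G₂ = ≡.trans T₂.β-clone (cong (λ a → (a + 0) + (cu + cu)) (Sum.∑-neither-comm 3 v u B))

  b>0 : ∀ {w} → Bad G u v w → 0 < b
  b>0 {w} bad = ≤-trans (≡.subst (0 <_) (≡.sym uvw-bad) z<s)
                        (≤-∑ᵛ 3 (Sum.select (both? u v) B) (u ∷ v ∷ w ∷ []))
    where
    uvw-bad : Sum.select (both? u v) B (u ∷ v ∷ w ∷ []) ≡ 1
    uvw-bad = ≡.trans (Sum.select-in (both? u v) B (here refl , there (here refl)))
                      (Sum.select-in (badTriple? G) _ bad)

  improve : ∀ {w} → Bad G u v w → ∃ λ H → IsSym H × IsMaximizer (D n) H × β H < β G
  improve bad with shrink a cu cv (b>0 bad)
  ... | inj₁ β₁< = G₁ , C₁.clone-sym , same-P-maximizer (C₁.clone-D (proj₁ G-max)) P-G₁ ,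
                   ≡.subst₂ _<_ (≡.sym β-G₁) (≡.sym β-G) β₁<
  ... | inj₂ β₂< = G₂ , C₂.clone-sym , same-P-maximizer (C₂.clone-D (proj₁ G-max)) P-G₂ ,
                   ≡.subst₂ _<_ (≡.sym β-G₂) (≡.sym β-G) β₂<

module _ {n : ℕ} {G : Multigraph n} where

  β≡0⇒¬Bad : β G ≡ 0 → ∀ {x y z} → ¬ Bad G x y z
  β≡0⇒¬Bad β≡0 {x} {y} {z} bad = n≮n 0 (≡.subst (0 <_) β≡0
    (≤-trans (≡.subst (0 <_) (≡.sym (Sum.select-in (badTriple? G) _ {x ∷ y ∷ z ∷ []} bad)) z<s)
             (≤-∑ᵛ 3 (badness G) (x ∷ y ∷ z ∷ []))))

  β>0⇒Bad : 0 < β G → ∃ (BadTriple G)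
  β>0⇒Bad β>0 with ∑ᵛ-positive 3 (badness G) β>0
  ... | xs , 0<badness = case badTriple? G xs of λ where
    (yes bad) → xs , bad
    (no ¬bad) → contradiction (≡.subst (0 <_) (Sum.select-out (badTriple? G) _ ¬bad) 0<badness) (n≮n 0)

descend : ∀ {n} {G : Multigraph n} → IsSym G → IsMaximizer (D n) G →
  ∃ λ H → IsSym H × IsMaximizer (D n) H × β H ≡ 0
descend {n} {G} G-sym G-max = go G-sym G-max (<-wellFounded (β G))
  where
  go : ∀ {G} → IsSym G → IsMaximizer (D n) G → Acc _<_ (β G) →
    ∃ λ H → IsSym H × IsMaximizer (D n) H × β H ≡ 0
  go {G} G-sym G-max (acc smaller) = case β G ℕ.≟ 0 of λ where
    (yes β≡0) → G , G-sym , G-max , β≡0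
    (no β≢0)  → case β>0⇒Bad (ℕ.n≢0⇒n>0 β≢0) of λ where
      ((u ∷ v ∷ w ∷ []) , bad@(u≢v , _ , _ , G-uv , _)) →
        let H , H-sym , H-max , βH<βG = Improve.improve G-sym G-max u≢v G-uv bad
        in go H-sym H-max (smaller βH<βG)

toℕ<⇒≢ : ∀ {n} {a b : Fin n} → toℕ a < toℕ b → a ≢ b
toℕ<⇒≢ a<b refl = n≮n _ a<b

no-triangle : ∀ {n} {G : Multigraph n} → IsSym G → β G ≡ 0 → ∀ {i j k p q} →
  (i ∷ j ∷ k ∷ []) ↭ (1 ∷ p ∷ q ∷ []) → p ≢ q → ¬ HasTriangle G i j k
no-triangle {G = G} G-sym β≡0 ijk↭ p≢q (a , b , c , a<b , b<c , abc↭ijk) =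
  case ↭-one-unbalanced (↭-trans abc↭ijk ijk↭) p≢q of λ where
    (inj₁ (ab≡1 , ac≢bc)) →
      β≡0⇒¬Bad β≡0 (a≢b , a≢c , b≢c , ab≡1 , ac≢bc)
    (inj₂ (inj₁ (ac≡1 , ab≢bc))) →
      β≡0⇒¬Bad β≡0 (a≢c , a≢b , b≢c ∘ ≡.sym , ac≡1 , λ eq → ab≢bc (≡.trans eq (G-sym c b)))
    (inj₂ (inj₂ (bc≡1 , ab≢ac))) →
      β≡0⇒¬Bad β≡0 (b≢c , a≢b ∘ ≡.sym , a≢c ∘ ≡.sym , bc≡1 ,
                    λ eq → ab≢ac (≡.trans (G-sym a b) (≡.trans eq (G-sym c a))))
  where
  a≢b = toℕ<⇒≢ a<b
  b≢c = toℕ<⇒≢ b<c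
  a≢c = toℕ<⇒≢ (ℕ.<-trans a<b b<c)

bad-free⇒C : ∀ {n} {H : Multigraph n} → IsSym H → D n H → β H ≡ 0 → C n H
bad-free⇒C H-sym D-H βH≡0 = D-H
  , no-triangle H-sym βH≡0 (↭-trans (swap 3 1 refl) (prep 1 (swap 3 1 refl))) (λ ())
  , no-triangle H-sym βH≡0 (↭-trans (swap 2 1 refl) (prep 1 (swap 2 1 refl))) (λ ())
  , no-triangle H-sym βH≡0 (↭-trans (prep 3 (swap 2 1 refl)) (swap 3 1 refl)) (λ ())

-- Existence of a maximizer

IsSQ? : ∀ {n} s q (G : Multigraph n) → Dec (IsSQ s q G)
IsSQ? s q G = map′
  (λ no-violation S ∣S∣≡s →
     decidable-stable (spanned G S ℕ.≤? q) λ ≰q → no-violation (S , ∣S∣≡s , ≰q))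
  (λ sq (S , ∣S∣≡s , ≰q) → ≰q (sq S ∣S∣≡s))
  (¬? (anySubset? λ S → (∣ S ∣ ℕ.≟ s) ×-dec ¬? (spanned G S ℕ.≤? q)))

D? : ∀ {n} (G : Multigraph n) → Dec (D n G)
D? G = IsSQ? 4 15 G ×-dec μ G ℕ.≤? 3 ×-dec IsSQ? 3 8 G

-- Multigraphs with all multiplicities at most m, coded by numbers via finToFun.
module Codes {n : ℕ} (m : ℕ) where

  Code : Set
  Code = Fin ((suc m ^ n) ^ n)

  decode : Code → Multigraph n
  decode c i j = toℕ (finToFun (finToFun c i) j)

  encode : Multigraph n → Code
  encode G = funToFin λ i → funToFin λ j → fromℕ< (s≤s (ℕ.m⊓n≤n (G i j) m))

  decode-encode : ∀ G i j → decode (encode G) i j ≡ G i j ⊓ m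
  decode-encode G i j = begin
    toℕ (finToFun (finToFun (encode G) i) j) ≡⟨ cong (λ c → toℕ (finToFun c j)) (finToFun-funToFin _ i) ⟩
    toℕ (finToFun (funToFin (code i)) j)      ≡⟨ cong toℕ (finToFun-funToFin (code i) j) ⟩
    toℕ (code i j)                            ≡⟨ toℕ-fromℕ< _ ⟩
    G i j ⊓ m                                 ∎
    where
    open ≡-Reasoning
    code : Fin n → Fin n → Fin (suc m)
    code i j = fromℕ< (s≤s (ℕ.m⊓n≤n (G i j) m))

  ≐-decode-encode : ∀ {G} → μ G ≤ m → G ≐ decode (encode G)
  ≐-decode-encode {G} μ≤m {i} {j} i<j =
    ≡.sym (≡.trans (decode-encode G i j) (ℕ.m≤n⇒m⊓n≡m (Equivalence.to μ≤⇔ μ≤m i<j)))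

maximizer-exists : ∀ {n} m (X : Multigraph n → Set) → (∀ G → Dec (X G)) →
  (∀ {G H} → G ≐ H → X G → X H) → (∀ {G} → X G → μ G ≤ m) →
  ∀ {G₀} → X G₀ → ∃ (IsMaximizer X)
maximizer-exists {n} m X X? X-resp X-μ {G₀} X-G₀ = decode best , X-best , best-max
  where
  open Codes m
  candidates : List Code
  candidates = filter (X? ∘ decode) (allFin _)
  best : Code
  best = argmax (P ∘ decode) (encode G₀) candidates
  coded : ∀ {G} → X G → X (decode (encode G))
  coded X-G = X-resp (≐-decode-encode (X-μ X-G)) X-G
  X-best : X (decode best)
  X-best = argmax-all (P ∘ decode) (coded X-G₀) (all-filter (X? ∘ decode) (allFin _))
  best-max : ∀ H → X H → P H ≤ P (decode best)
  best-max H X-H = ≡.subst (_≤ P (decode best)) (≡.sym (P-resp-≐ (≐-decode-encode (X-μ X-H))))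
    (All.lookup (f[xs]≤f[argmax] {f = P ∘ decode} (encode G₀) candidates)
                (∈-filter⁺ (X? ∘ decode) (∈-allFin (encode H)) (coded X-H)))

symmetric-maximizer : ∀ n → ∃ λ G → IsSym G × IsMaximizer (D n) G
symmetric-maximizer n =
  let G , D-G , G-max = maximizer-exists 3 (D n) D? D-resp-≐ μ≤3 ones-D
      G≐ = ≐-sym (symmetrize-≐ G)
  in symmetrize G , symmetrize-sym G , D-resp-≐ G≐ D-G ,
     λ H D-H → ≡.subst (P H ≤_) (P-resp-≐ G≐) (G-max H D-H)
  where
  μ≤3 : ∀ {G} → D n G → μ G ≤ 3
  μ≤3 (_ , μ≤3 , _) = μ≤3

C-maximizer⇒D-maximizer : ∀ {n} {H G : Multigraph n} → IsMaximizer (D n) H → C n H →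
  IsMaximizer (C n) G → IsMaximizer (D n) G
C-maximizer⇒D-maximizer (_ , H-max) C-H ((D-G , _) , G-max) = D-G , λ K D-K → ≤-trans (H-max K D-K) (G-max _ C-H)

lemma5p6 : (n : ℕ) → 1 ≤ n →
    Σ (Multigraph n) (λ G → IsMaximizer (D n) G × C n G)
    × ((G : Multigraph n) → IsMaximizer (C n) G → IsMaximizer (D n) G)
lemma5p6 n _ =
  let G , G-sym , G-max = symmetric-maximizer n
      H , H-sym , H-max , βH≡0 = descend G-sym G-max
      C-H = bad-free⇒C H-sym (proj₁ H-max) βH≡0
  in (H , H-max , C-H) , λ _ → C-maximizer⇒D-maximizer H-max C-H
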